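{- Let $l\in\mathbb{Z}_v^*$, $l\ne 1$, and let $\mathrm{o}(l)$ denote the multiplicative order of $l$ in $\mathbb{Z}_v^*$. (i) If $\mathrm{o}(l)>3$, then $N(v,3,l)=0$. (ii) If $\mathrm{o}(l)=2$, then $N(v,3,l)=0$ if $l+1\equiv 0\pmod v$, or if $v\equiv 0\pmod 4$ and $l\equiv 1\pmod{v/2}$; otherwise $N(v,3,l)=\frac{3\phi(v)}{2}$. (iii) If $\mathrm{o}(l)=3$, then $N(v,3,l)=0$ if $l^2+l+1\not\equiv 0\pmod v$, and $N(v,3,l)=\phi(v)$ otherwise.
   Context: $B_{\rm con}(v,3)$ is the set of $3$-element subsets $X\subseteq\mathbb{Z}_v$ with $|X-X|=7$ (where $X-X=\{x_1-x_2:x_1,x_2\in X\}$) and $\langle X-X\rangle=\mathbb{Z}_v$. For $l\in\mathbb{Z}_v^*$, $N(v,3,l)$ is the number of $X\in B_{\rm con}(v,3)$ with $0\in X$ and $lX=X-x$ for some $x\in X$, where $lX=\{lx:x\in X\}$. $\phi$ is Euler's function. -}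

module Defs where

open import Data.Nat using (ℕ; zero; suc; _+_; _*_; _∸_; _^_; _≤_; _<_; NonZero)
open import Data.Nat.DivMod using (_mod_)
open import Data.Nat.Coprimality using (Coprime; coprime?)
open import Data.Fin using (Fin; toℕ)
open import Data.Fin.Subset using (Subset; _∈_; ∣_∣)
open import Data.List using (List; length; filter; upTo)
open import Data.List.Membership.Propositional renaming (_∈_ to _∈ₗ_)
open import Data.List.Relation.Unary.Unique.Propositional using (Unique)
open import Data.Product using (Σ; ∃; ∃-syntax; _×_)
open import Function.Bundles using (_⇔_)
open import Relation.Binary.PropositionalEquality using (_≡_)
open import Relation.Nullary using (¬_)

CountIs : {A : Set} → (A → Set) → ℕ → Set
CountIs {A} P k =
  Σ (List A) λ xs → Unique xs × (∀ a → (a ∈ₗ xs) ⇔ P a) × length xs ≡ k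

φ : ℕ → ℕ
φ v = length (filter (λ k → coprime? k v) (upTo v))

module ℤmod (v : ℕ) .{{_ : NonZero v}} where

  ℤv : Set
  ℤv = Fin v

  [_] : ℕ → ℤv
  [ n ] = n mod v

  0v 1v : ℤv
  0v = [ 0 ]
  1v = [ 1 ]

  infixl 6 _+v_ _-v_
  infixl 7 _*v_

  _+v_ : ℤv → ℤv → ℤv
  a +v b = [ toℕ a + toℕ b ]

  -v_ : ℤv → ℤv
  -v a = [ v ∸ toℕ a ]

  _-v_ : ℤv → ℤv → ℤv
  a -v b = a +v (-v b)

  _*v_ : ℤv → ℤv → ℤv
  a *v b = [ toℕ a * toℕ b ]

  _^v_ : ℤv → ℕ → ℤv
  a ^v k = [ toℕ a ^ k ]

  IsUnit : ℤv → Set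
  IsUnit l = Coprime (toℕ l) v

  IsOrder : ℤv → ℕ → Set
  IsOrder l k = 1 ≤ k × l ^v k ≡ 1v × (∀ j → 1 ≤ j → j < k → ¬ (l ^v j ≡ 1v))

  InDiff : Subset v → ℤv → Set
  InDiff X d = ∃[ x₁ ] ∃[ x₂ ] (x₁ ∈ X × x₂ ∈ X × x₁ -v x₂ ≡ d)

  data InSpan (D : ℤv → Set) : ℤv → Set where
    span-0   : InSpan D 0v
    span-gen : ∀ {d} → D d → InSpan D d
    span-+   : ∀ {a b} → InSpan D a → InSpan D b → InSpan D (a +v b)
    span-neg : ∀ {a} → InSpan D a → InSpan D (-v a)

  InBcon3 : Subset v → Set
  InBcon3 X = ∣ X ∣ ≡ 3 × CountIs (InDiff X) 7 × (∀ z → InSpan (InDiff X) z)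

  InScaled : ℤv → Subset v → ℤv → Set
  InScaled l X y = ∃[ x ] (x ∈ X × y ≡ l *v x)

  InShift : Subset v → ℤv → ℤv → Set
  InShift X x y = ∃[ x' ] (x' ∈ X × y ≡ x' -v x)

  ScaledEqShift : ℤv → Subset v → ℤv → Set
  ScaledEqShift l X x = ∀ y → InScaled l X y ⇔ InShift X x y

  NCond : ℤv → Subset v → Set
  NCond l X = InBcon3 X × 0v ∈ X × ∃[ x ] (x ∈ X × ScaledEqShift l X x)

  N≡ : ℤv → ℕ → Set
  N≡ l k = CountIs (NCond l) k

-- For X = {0, a, b} with lX = X - x, the affine map y ↦ l y + x permutes X.  It cannot fix
-- both a and b, since l - 1 would then annihilate ⟨X - X⟩ = ℤ_v.  Swapping a and b forces
-- l² = 1 and X = {0, c, l c}; fixing one point forces l² = 1 and X = {0, -c, (l - 1) c};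
-- a 3-cycle forces l² + l + 1 = 0 and X = {0, c, (1 + l) c}.  In each case c is a unit,
-- because its multiples contain X and hence generate ℤ_v.  Conversely such a set lies in
-- B_con(v,3) exactly when nine explicit elements are non-zero, which for l² = 1 means
-- l ≠ -1 and 2(l - 1) ≠ 0, and is automatic when l² + l + 1 = 0.  Counting units c gives
-- φ(v) or, since {0, c, l c} = {0, l c, c}, φ(v)/2 + φ(v) = 3φ(v)/2.

module Submission where

open import Defs
open import Data.Nat using (ℕ; _+_; _*_; _∸_; _^_; _<_; _/_; NonZero)
open import Data.Nat.Divisibility using (_∣_)
open import Data.Fin using (toℕ)
open import Data.Sum using (_⊎_)
open import Data.Product using (_×_)
open import Relation.Binary.PropositionalEquality using (_≡_)
open import Relation.Nullary using (¬_)

open import Algebra.Bundles using (CommutativeRing)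
open import Algebra.Structures using (IsCommutativeRing)
import Algebra.Properties.AbelianGroup as AbelianGroupProperties
import Algebra.Properties.Group as GroupProperties
import Algebra.Properties.Ring as RingProperties
import Algebra.Solver.Ring as RingSolver
open import Algebra.Solver.Ring.AlmostCommutativeRing using (fromCommutativeRing; _-Raw-AlmostCommutative⟶_)
open import Data.Empty using (⊥; ⊥-elim)
open import Data.Fin using (Fin; zero; suc)
open import Data.Fin.Properties using (_≟_; toℕ-fromℕ<; toℕ-injective; toℕ<n)
open import Data.Fin.Subset using (Subset; _∉_; _∪_; ⁅_⁆; _-_; Nonempty; inside; outside)
  renaming (_∈_ to _∈ₛ_; ∣_∣ to ∣_∣ₛ)
open import Data.Fin.Subset.Properties
  using (x∈⁅x⁆; x∈⁅y⁆⇒x≡y; ∣⁅x⁆∣≡1; x∈p∪q⁺; x∈p∪q⁻; p─q⊆p; p─⊥≡p; x∈p∧x≢y⇒x∈p-y; ⊆-antisym; ∪-identityˡ)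
import Data.Integer as ℤ
import Data.Integer.Properties as ℤP
open import Data.List using (List; []; _∷_; _++_; map; filter; length; tabulate; applyUpTo; upTo; allFin)
open import Data.List.Membership.Propositional using (_∈_; _─_)
open import Data.List.Membership.Propositional.Properties
  using (∈-filter⁺; ∈-filter⁻; ∈-allFin; ∈-map⁺; ∈-map⁻; ∈-++⁺ˡ; ∈-++⁺ʳ; ∈-++⁻)
open import Data.List.Properties using (length-removeAt′; map-tabulate; length-map; length-++)
open import Data.List.Relation.Binary.Subset.Propositional using (_⊆_)
open import Data.List.Relation.Unary.All as All using ([]; _∷_)
import Data.List.Relation.Unary.All.Properties as All
open import Data.List.Relation.Unary.AllPairs using ([]; _∷_)
open import Data.List.Relation.Unary.Any using (here; there; index)
open import Data.List.Relation.Unary.Unique.Propositional using (Unique)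
import Data.List.Relation.Unary.Unique.Propositional.Properties as Unique
open import Data.Maybe using (Maybe; just; nothing)
open import Data.Nat using (zero; suc; _≤_; z≤n; s≤s; _%_; _<?_; >-nonZero⁻¹)
open import Data.Nat.Coprimality using (coprime-Bézout; coprime?; ¬0-coprimeTo-2+)
open import Data.Nat.Divisibility
  using (divides; ∣⇒≤; ∣-refl; ∣-trans; ∣1⇒≡1; n∣m*n; %-presˡ-∣; m%n≡0⇒n∣m; n∣m⇒m%n≡0)
open import Data.Nat.DivMod
  using (m*n/n≡m; m/n*n≡m; m≡m%n+[m/n]*n; %-distribˡ-+; %-distribˡ-*; n%n≡0; m*n%n≡0; m%n<n; m<n⇒m%n≡m)
open import Data.Nat.GCD using (module Bézout)
open import Data.Nat.Properties
  using ( +-comm; +-assoc; +-suc; +-identityʳ; *-comm; *-assoc; *-distribˡ-+; *-identityˡ; *-identityʳ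
        ; m+[n∸m]≡n; m+n≡0⇒m≡0; suc-injective; n<1+n; m≤m+n; +-mono-<
        ; <⇒≤; <-trans; <-≤-trans; ≤-trans; ≤-reflexive; <-irrefl; <-asym; ≤-antisym; ≤∧≢⇒<; ≮⇒≥)
open import Data.Nat.Tactic.RingSolver using (solve-∀)
open import Data.Product using (∃-syntax; _,_; proj₁; proj₂)
open import Data.Sign as Sign using (Sign)
open import Data.Sum using (inj₁; inj₂; [_,_]′)
import Data.Sum as Sum
open import Data.Vec using (_∷_; _[_]=_)
open _[_]=_ renaming (here to hereᵥ; there to thereᵥ)
open import Function using (_∘_; id)
open import Function.Bundles using (Equivalence; mk⇔)
open import Level using (0ℓ)
open import Relation.Binary.PropositionalEquality
  using (_≢_; refl; sym; trans; cong; cong₂; subst; isEquivalence; module ≡-Reasoning)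
open import Relation.Nullary using (Dec; yes; no)
open import Relation.Nullary.Decidable using (¬?)
open import Relation.Unary using (Pred; Decidable)

open ≡-Reasoning

module Lists {A : Set} where

  ∈-─⁻ : ∀ {x z : A} {xs} (p : x ∈ xs) → z ∈ xs → z ≡ x ⊎ z ∈ xs ─ p
  ∈-─⁻ (here refl) (here refl) = inj₁ refl
  ∈-─⁻ (here _)    (there q)   = inj₂ q
  ∈-─⁻ (there p)   (here refl) = inj₂ (here refl)
  ∈-─⁻ (there p)   (there q)   = Sum.map₂ there (∈-─⁻ p q)

  Unique-⊆⇒length≤ : ∀ {xs ys : List A} → Unique xs → xs ⊆ ys → length xs ≤ length ys
  Unique-⊆⇒length≤ {[]}              _          _   = z≤n
  Unique-⊆⇒length≤ {x ∷ xs} {ys} (x∉xs ∷ u) xs⊆ys =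
    subst (suc (length xs) ≤_) (sym (length-removeAt′ ys (index x∈ys)))
      (s≤s (Unique-⊆⇒length≤ u λ z∈xs →
        [ (λ z≡x → ⊥-elim (All.lookup x∉xs z∈xs (sym z≡x))) , id ]′ (∈-─⁻ x∈ys (xs⊆ys (there z∈xs)))))
    where
    x∈ys = xs⊆ys (here refl)

  Unique-⊆-repeat⇒length< : ∀ {x} {zs xs : List A} → Unique zs → zs ⊆ xs →
                              (p : x ∈ xs) → x ∈ xs ─ p → length zs < length xs
  Unique-⊆-repeat⇒length< {xs = xs} u zs⊆xs p x∈xs─p =
    subst (suc _ ≤_) (sym (length-removeAt′ xs (index p)))
      (s≤s (Unique-⊆⇒length≤ u λ z∈zs →
        [ (λ { refl → x∈xs─p }) , id ]′ (∈-─⁻ p (zs⊆xs z∈zs))))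

  Unique-map⁺ : ∀ {B : Set} (f : A → B) {xs} →
                (∀ {x y} → x ∈ xs → y ∈ xs → f x ≡ f y → x ≡ y) → Unique xs → Unique (map f xs)
  Unique-map⁺ f {[]}     inj []           = []
  Unique-map⁺ f {x ∷ xs} inj (x∉xs ∷ u) =
    All.map⁺ (All.tabulate λ y∈xs fx≡fy → All.lookup x∉xs y∈xs (inj (here refl) (there y∈xs) fx≡fy))
    ∷ Unique-map⁺ f (λ x∈ y∈ → inj (there x∈) (there y∈)) u

  module _ {P : Pred A 0ℓ} (P? : Decidable P) where

    length-filter+length-filter-¬ : ∀ xs →
      length (filter P? xs) + length (filter (¬? ∘ P?) xs) ≡ length xs
    length-filter+length-filter-¬ [] = refl
    length-filter+length-filter-¬ (x ∷ xs) with P? x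
    ... | yes _ = cong suc (length-filter+length-filter-¬ xs)
    ... | no  _ = trans (+-suc _ _) (cong suc (length-filter+length-filter-¬ xs))

  length-filter-map : ∀ {B : Set} {P : Pred B 0ℓ} (P? : Decidable P) (f : A → B) xs →
                      length (filter P? (map f xs)) ≡ length (filter (P? ∘ f) xs)
  length-filter-map P? f [] = refl
  length-filter-map P? f (x ∷ xs) with P? (f x)
  ... | yes _ = cong suc (length-filter-map P? f xs)
  ... | no  _ = length-filter-map P? f xs

  tabulate-∘toℕ : ∀ n (f : ℕ → A) → tabulate {n = n} (f ∘ toℕ) ≡ applyUpTo f n
  tabulate-∘toℕ zero    f = refl
  tabulate-∘toℕ (suc n) f = cong (f 0 ∷_) (tabulate-∘toℕ n (f ∘ suc))

open Lists

CountIs-none : ∀ {A : Set} {P : A → Set} → (∀ a → ¬ P a) → CountIs P 0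
CountIs-none ¬P = [] , [] , (λ a → mk⇔ (λ ()) (⊥-elim ∘ ¬P a)) , refl

[h+[h+h]]*2≡3*[h+h] : ∀ h → (h + (h + h)) * 2 ≡ 3 * (h + h)
[h+[h+h]]*2≡3*[h+h] = solve-∀

[n+n+k*n≡[2+k]*n] : ∀ n k → n + n + k * n ≡ suc (suc k) * n
[n+n+k*n≡[2+k]*n] = solve-∀

[h*2+h*2≡h*4] : ∀ h → h * 2 + h * 2 ≡ h * 4
[h*2+h*2≡h*4] = solve-∀

[m+m≡m*2] : ∀ m → m + m ≡ m * 2
[m+m≡m*2] = solve-∀

[q*h+q*h≡q*[h*2]] : ∀ q h → q * h + q * h ≡ q * (h * 2)
[q*h+q*h≡q*[h*2]] = solve-∀

map-toℕ-allFin : ∀ n → map toℕ (allFin n) ≡ upTo n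
map-toℕ-allFin n = trans (map-tabulate id toℕ) (tabulate-∘toℕ n id)

private variable n : ℕ

x∉p-x : ∀ {x : Fin n} {p} → x ∉ p - x
x∉p-x {x = zero}  {inside ∷ p}  ()
x∉p-x {x = zero}  {outside ∷ p} ()
x∉p-x {x = suc x} {inside ∷ p}  (thereᵥ m) = x∉p-x m
x∉p-x {x = suc x} {outside ∷ p} (thereᵥ m) = x∉p-x m

x∈p⇒1+∣p-x∣≡∣p∣ : ∀ {x : Fin n} {p} → x ∈ₛ p → suc ∣ p - x ∣ₛ ≡ ∣ p ∣ₛ
x∈p⇒1+∣p-x∣≡∣p∣ {x = zero}  {inside ∷ p}  hereᵥ     = cong suc (cong ∣_∣ₛ (p─⊥≡p p))
x∈p⇒1+∣p-x∣≡∣p∣ {x = suc x} {inside ∷ p}  (thereᵥ m) = cong suc (x∈p⇒1+∣p-x∣≡∣p∣ m)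
x∈p⇒1+∣p-x∣≡∣p∣ {x = suc x} {outside ∷ p} (thereᵥ m) = x∈p⇒1+∣p-x∣≡∣p∣ m

x∉p⇒∣⁅x⁆∪p∣≡1+∣p∣ : ∀ {x : Fin n} {p} → x ∉ p → ∣ ⁅ x ⁆ ∪ p ∣ₛ ≡ suc ∣ p ∣ₛ
x∉p⇒∣⁅x⁆∪p∣≡1+∣p∣ {x = zero}  {inside ∷ p}  x∉p = ⊥-elim (x∉p hereᵥ)
x∉p⇒∣⁅x⁆∪p∣≡1+∣p∣ {x = zero}  {outside ∷ p} _   = cong suc (cong ∣_∣ₛ (∪-identityˡ p))
x∉p⇒∣⁅x⁆∪p∣≡1+∣p∣ {x = suc x} {inside ∷ p}  x∉p = cong suc (x∉p⇒∣⁅x⁆∪p∣≡1+∣p∣ (x∉p ∘ thereᵥ))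
x∉p⇒∣⁅x⁆∪p∣≡1+∣p∣ {x = suc x} {outside ∷ p} x∉p = x∉p⇒∣⁅x⁆∪p∣≡1+∣p∣ (x∉p ∘ thereᵥ)

∣p∣≡1+k⇒Nonempty : ∀ {p : Subset n} {k} → ∣ p ∣ₛ ≡ suc k → Nonempty p
∣p∣≡1+k⇒Nonempty {p = inside ∷ p}  _ = zero , hereᵥ
∣p∣≡1+k⇒Nonempty {p = outside ∷ p} e with y , y∈p ← ∣p∣≡1+k⇒Nonempty {p = p} e = suc y , thereᵥ y∈p

triple : Fin n → Fin n → Fin n → Subset n
triple p q r = ⁅ p ⁆ ∪ ⁅ q ⁆ ∪ ⁅ r ⁆

OneOf : Fin n → Fin n → Fin n → Fin n → Set
OneOf y p q r = y ≡ p ⊎ y ≡ q ⊎ y ≡ r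

∈-triple⁺ : ∀ {y p q r : Fin n} → OneOf y p q r → y ∈ₛ triple p q r
∈-triple⁺ {p = p} (inj₁ refl)        = x∈p∪q⁺ (inj₁ (x∈⁅x⁆ p))
∈-triple⁺ {q = q} (inj₂ (inj₁ refl)) = x∈p∪q⁺ (inj₂ (x∈p∪q⁺ (inj₁ (x∈⁅x⁆ q))))
∈-triple⁺ {r = r} (inj₂ (inj₂ refl)) = x∈p∪q⁺ (inj₂ (x∈p∪q⁺ (inj₂ (x∈⁅x⁆ r))))

∈-triple⁻ : ∀ {y p q r : Fin n} → y ∈ₛ triple p q r → OneOf y p q r
∈-triple⁻ {p = p} {q} {r} y∈ with x∈p∪q⁻ ⁅ p ⁆ (⁅ q ⁆ ∪ ⁅ r ⁆) y∈
... | inj₁ y∈p  = inj₁ (x∈⁅y⁆⇒x≡y p y∈p)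
... | inj₂ y∈qr = inj₂ (Sum.map (x∈⁅y⁆⇒x≡y q) (x∈⁅y⁆⇒x≡y r) (x∈p∪q⁻ ⁅ q ⁆ ⁅ r ⁆ y∈qr))

∈-triple₁ : ∀ {p q r : Fin n} → p ∈ₛ triple p q r
∈-triple₁ = ∈-triple⁺ (inj₁ refl)

∈-triple₂ : ∀ {p q r : Fin n} → q ∈ₛ triple p q r
∈-triple₂ = ∈-triple⁺ (inj₂ (inj₁ refl))

∈-triple₃ : ∀ {p q r : Fin n} → r ∈ₛ triple p q r
∈-triple₃ = ∈-triple⁺ (inj₂ (inj₂ refl))

triple-swap : ∀ (p q r : Fin n) → triple p q r ≡ triple p r q
triple-swap p q r = ⊆-antisym swap swap
  where
  swap : ∀ {p q r y} → y ∈ₛ triple p q r → y ∈ₛ triple p r q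
  swap = ∈-triple⁺ ∘ Sum.map₂ Sum.swap ∘ ∈-triple⁻

∣triple∣≡3 : ∀ {p q r : Fin n} → p ≢ q → p ≢ r → q ≢ r → ∣ triple p q r ∣ₛ ≡ 3
∣triple∣≡3 {p = p} {q} {r} p≢q p≢r q≢r = begin
  ∣ ⁅ p ⁆ ∪ ⁅ q ⁆ ∪ ⁅ r ⁆ ∣ₛ  ≡⟨ x∉p⇒∣⁅x⁆∪p∣≡1+∣p∣ p∉qr ⟩
  suc ∣ ⁅ q ⁆ ∪ ⁅ r ⁆ ∣ₛ      ≡⟨ cong suc (x∉p⇒∣⁅x⁆∪p∣≡1+∣p∣ (q≢r ∘ x∈⁅y⁆⇒x≡y r)) ⟩
  suc (suc ∣ ⁅ r ⁆ ∣ₛ)        ≡⟨ cong (λ k → suc (suc k)) (∣⁅x⁆∣≡1 r) ⟩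
  3                          ∎
  where
  p∉qr : p ∉ ⁅ q ⁆ ∪ ⁅ r ⁆
  p∉qr p∈ = [ p≢q ∘ x∈⁅y⁆⇒x≡y q , p≢r ∘ x∈⁅y⁆⇒x≡y r ]′ (x∈p∪q⁻ ⁅ q ⁆ ⁅ r ⁆ p∈)

triple-decomposition : ∀ {X : Subset n} {z} → ∣ X ∣ₛ ≡ 3 → z ∈ₛ X →
  ∃[ a ] ∃[ b ] (X ≡ triple z a b × z ≢ a × z ≢ b × a ≢ b)
triple-decomposition {X = X} {z} ∣X∣≡3 z∈X = pick-a (∣p∣≡1+k⇒Nonempty ∣X-z∣≡2)
  where
  ∣X-z∣≡2 : ∣ X - z ∣ₛ ≡ 2
  ∣X-z∣≡2 = suc-injective (trans (x∈p⇒1+∣p-x∣≡∣p∣ z∈X) ∣X∣≡3)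
  pick-a : Nonempty (X - z) → ∃[ a ] ∃[ b ] (X ≡ triple z a b × z ≢ a × z ≢ b × a ≢ b)
  pick-a (a , a∈X-z) = pick-b (∣p∣≡1+k⇒Nonempty ∣X-z-a∣≡1)
    where
    ∣X-z-a∣≡1 : ∣ X - z - a ∣ₛ ≡ 1
    ∣X-z-a∣≡1 = suc-injective (trans (x∈p⇒1+∣p-x∣≡∣p∣ a∈X-z) ∣X-z∣≡2)
    pick-b : Nonempty (X - z - a) → ∃[ a ] ∃[ b ] (X ≡ triple z a b × z ≢ a × z ≢ b × a ≢ b)
    pick-b (b , b∈X-z-a) = a , b , ⊆-antisym ⊆triple triple⊆ , z≢a , z≢b , a≢b
      where
      ∣X-z-a-b∣≡0 : ∣ X - z - a - b ∣ₛ ≡ 0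
      ∣X-z-a-b∣≡0 = suc-injective (trans (x∈p⇒1+∣p-x∣≡∣p∣ b∈X-z-a) ∣X-z-a∣≡1)
      b∈X-z = p─q⊆p (X - z) ⁅ a ⁆ b∈X-z-a
      z≢a : z ≢ a
      z≢a refl = x∉p-x a∈X-z
      z≢b : z ≢ b
      z≢b refl = x∉p-x b∈X-z
      a≢b : a ≢ b
      a≢b refl = x∉p-x b∈X-z-a
      ⊆triple : ∀ {y} → y ∈ₛ X → y ∈ₛ triple z a b
      ⊆triple {y} y∈X with y ≟ z | y ≟ a | y ≟ b
      ... | yes y≡z | _       | _       = ∈-triple⁺ (inj₁ y≡z)
      ... | no  _   | yes y≡a | _       = ∈-triple⁺ (inj₂ (inj₁ y≡a))
      ... | no  _   | no  _   | yes y≡b = ∈-triple⁺ (inj₂ (inj₂ y≡b))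
      ... | no y≢z  | no y≢a  | no y≢b  with () ← trans (x∈p⇒1+∣p-x∣≡∣p∣
              (x∈p∧x≢y⇒x∈p-y (x∈p∧x≢y⇒x∈p-y (x∈p∧x≢y⇒x∈p-y y∈X y≢z) y≢a) y≢b)) ∣X-z-a-b∣≡0
      triple⊆ : ∀ {y} → y ∈ₛ triple z a b → y ∈ₛ X
      triple⊆ y∈ with ∈-triple⁻ y∈
      ... | inj₁ refl        = z∈X
      ... | inj₂ (inj₁ refl) = p─q⊆p X ⁅ z ⁆ a∈X-z
      ... | inj₂ (inj₂ refl) = p─q⊆p X ⁅ z ⁆ b∈X-z

n≢0⇒1+[n∸1]≡n : ∀ {n} → n ≢ 0 → suc (n ∸ 1) ≡ n
n≢0⇒1+[n∸1]≡n {zero}  n≢0 = ⊥-elim (n≢0 refl)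
n≢0⇒1+[n∸1]≡n {suc n} _   = refl

m<n∧n∣m+m⇒m≡0⊎n≡m+m : ∀ {m n} → m < n → n ∣ m + m → m ≡ 0 ⊎ n ≡ m + m
m<n∧n∣m+m⇒m≡0⊎n≡m+m {m} {n} m<n (divides zero m+m≡0)   = inj₁ (m+n≡0⇒m≡0 m m+m≡0)
m<n∧n∣m+m⇒m≡0⊎n≡m+m {m} {n} m<n (divides 1 m+m≡n+0)   = inj₂ (sym (trans m+m≡n+0 (+-identityʳ n)))
m<n∧n∣m+m⇒m≡0⊎n≡m+m {m} {n} m<n (divides (suc (suc k)) m+m≡[2+k]n) =
  ⊥-elim (<-irrefl refl (<-≤-trans (+-mono-< m<n m<n)
    (≤-trans (m≤m+n (n + n) (k * n)) (≤-reflexive (trans ([n+n+k*n≡[2+k]*n] n k) (sym m+m≡[2+k]n))))))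

2∣1+m⊎4∣m+m : ∀ m → 2 ∣ suc m ⊎ 4 ∣ m + m
2∣1+m⊎4∣m+m m with m % 2 | m%n<n m 2 | m≡m%n+[m/n]*n m 2
... | 0 | _ | m≡[m/2]*2 = inj₂ (divides (m / 2) (trans (cong₂ _+_ m≡[m/2]*2 m≡[m/2]*2) ([h*2+h*2≡h*4] (m / 2))))
... | 1 | _ | m≡1+[m/2]*2 = inj₁ (divides (suc (m / 2)) (cong suc m≡1+[m/2]*2))
... | suc (suc _) | s≤s (s≤s ()) | _

[m+m]/2≡m : ∀ m → (m + m) / 2 ≡ m
[m+m]/2≡m m = trans (cong (_/ 2) ([m+m≡m*2] m)) (m*n/n≡m m 2)

n/2∣m⇒n∣m+m : ∀ {m n} → 2 ∣ n → n / 2 ∣ m → n ∣ m + m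
n/2∣m⇒n∣m+m {m} {n} 2∣n (divides q m≡q*[n/2]) = divides q (begin
  m + m                       ≡⟨ cong₂ _+_ m≡q*[n/2] m≡q*[n/2] ⟩
  q * (n / 2) + q * (n / 2)   ≡⟨ [q*h+q*h≡q*[h*2]] q (n / 2) ⟩
  q * (n / 2 * 2)             ≡⟨ cong (q *_) (m/n*n≡m 2∣n) ⟩
  q * n                       ∎)

-- The case split is needed because 1 % n is 0, not 1, when n = 1.
∣n∧∣1%n⇒∣1 : ∀ n .{{_ : NonZero n}} {d} → d ∣ n → d ∣ 1 % n → d ∣ 1
∣n∧∣1%n⇒∣1 1             d∣n _       = d∣n
∣n∧∣1%n⇒∣1 (suc (suc _)) _   d∣1%n = d∣1%n

v≤2⇒unit≡1 : ∀ v .{{_ : NonZero v}} (l : Fin v) → ℤmod.IsUnit v l → v ≤ 2 → l ≡ ℤmod.1v v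
v≤2⇒unit≡1 1 zero _ _ = refl
v≤2⇒unit≡1 2 zero 0-coprime-2 _ = ⊥-elim (¬0-coprimeTo-2+ 0-coprime-2)
v≤2⇒unit≡1 2 (suc zero) _ _ = refl
v≤2⇒unit≡1 (suc (suc (suc _))) _ _ (s≤s (s≤s ()))

module Residues (v : ℕ) .{{_ : NonZero v}} where
  open ℤmod v
  open ℤ using (ℤ; +_; -[1+_])

  0%v≡0 : 0 % v ≡ 0
  0%v≡0 = m<n⇒m%n≡m (>-nonZero⁻¹ v)

  toℕ-[] : ∀ n → toℕ [ n ] ≡ n % v
  toℕ-[] n = toℕ-fromℕ< (m%n<n n v)

  []-≡ : ∀ {m n} → m % v ≡ n % v → [ m ] ≡ [ n ]
  []-≡ {m} {n} eq = toℕ-injective (trans (toℕ-[] m) (trans eq (sym (toℕ-[] n))))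

  []-toℕ : ∀ a → [ toℕ a ] ≡ a
  []-toℕ a = toℕ-injective (trans (toℕ-[] (toℕ a)) (m<n⇒m%n≡m (toℕ<n a)))

  []-+ : ∀ m n → [ m ] +v [ n ] ≡ [ m + n ]
  []-+ m n = []-≡ (begin
    (toℕ [ m ] + toℕ [ n ]) % v ≡⟨ cong₂ (λ a b → (a + b) % v) (toℕ-[] m) (toℕ-[] n) ⟩
    (m % v + n % v) % v         ≡⟨ %-distribˡ-+ m n v ⟨
    (m + n) % v                 ∎)

  []-* : ∀ m n → [ m ] *v [ n ] ≡ [ m * n ]
  []-* m n = []-≡ (begin
    (toℕ [ m ] * toℕ [ n ]) % v ≡⟨ cong₂ (λ a b → (a * b) % v) (toℕ-[] m) (toℕ-[] n) ⟩
    (m % v * (n % v)) % v       ≡⟨ %-distribˡ-* m n v ⟨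
    (m * n) % v                 ∎)

  [v]≡0 : [ v ] ≡ 0v
  [v]≡0 = []-≡ (trans (n%n≡0 v) (sym (0%v≡0)))

  [k*v]≡0 : ∀ k → [ k * v ] ≡ 0v
  [k*v]≡0 k = []-≡ (trans (m*n%n≡0 k v) (sym (0%v≡0)))

  []≡0⇒∣ : ∀ n → [ n ] ≡ 0v → v ∣ n
  []≡0⇒∣ n eq = m%n≡0⇒n∣m n v (trans (sym (toℕ-[] n)) (trans (cong toℕ eq) (trans (toℕ-[] 0) (0%v≡0))))

  ∣⇒[]≡0 : ∀ n → v ∣ n → [ n ] ≡ 0v
  ∣⇒[]≡0 n v∣n = []-≡ (trans (n∣m⇒m%n≡0 n v v∣n) (sym (0%v≡0)))

  +v-comm : ∀ a b → a +v b ≡ b +v a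
  +v-comm a b = cong [_] (+-comm (toℕ a) (toℕ b))

  *v-comm : ∀ a b → a *v b ≡ b *v a
  *v-comm a b = cong [_] (*-comm (toℕ a) (toℕ b))

  +v-assoc : ∀ a b c → (a +v b) +v c ≡ a +v (b +v c)
  +v-assoc a b c = begin
    [ toℕ a + toℕ b ] +v c            ≡⟨ cong ([ toℕ a + toℕ b ] +v_) ([]-toℕ c) ⟨
    [ toℕ a + toℕ b ] +v [ toℕ c ]    ≡⟨ []-+ _ _ ⟩
    [ toℕ a + toℕ b + toℕ c ]         ≡⟨ cong [_] (+-assoc (toℕ a) _ _) ⟩
    [ toℕ a + (toℕ b + toℕ c) ]       ≡⟨ []-+ _ _ ⟨
    [ toℕ a ] +v [ toℕ b + toℕ c ]    ≡⟨ cong (_+v [ toℕ b + toℕ c ]) ([]-toℕ a) ⟩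
    a +v (b +v c)                     ∎

  *v-assoc : ∀ a b c → (a *v b) *v c ≡ a *v (b *v c)
  *v-assoc a b c = begin
    [ toℕ a * toℕ b ] *v c            ≡⟨ cong ([ toℕ a * toℕ b ] *v_) ([]-toℕ c) ⟨
    [ toℕ a * toℕ b ] *v [ toℕ c ]    ≡⟨ []-* _ _ ⟩
    [ toℕ a * toℕ b * toℕ c ]         ≡⟨ cong [_] (*-assoc (toℕ a) _ _) ⟩
    [ toℕ a * (toℕ b * toℕ c) ]       ≡⟨ []-* _ _ ⟨
    [ toℕ a ] *v [ toℕ b * toℕ c ]    ≡⟨ cong (_*v [ toℕ b * toℕ c ]) ([]-toℕ a) ⟩
    a *v (b *v c)                     ∎

  *v-distribˡ-+v : ∀ a b c → a *v (b +v c) ≡ a *v b +v a *v c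
  *v-distribˡ-+v a b c = begin
    a *v [ toℕ b + toℕ c ]             ≡⟨ cong (_*v [ toℕ b + toℕ c ]) ([]-toℕ a) ⟨
    [ toℕ a ] *v [ toℕ b + toℕ c ]     ≡⟨ []-* _ _ ⟩
    [ toℕ a * (toℕ b + toℕ c) ]        ≡⟨ cong [_] (*-distribˡ-+ (toℕ a) _ _) ⟩
    [ toℕ a * toℕ b + toℕ a * toℕ c ]  ≡⟨ []-+ _ _ ⟨
    a *v b +v a *v c                   ∎

  +v-identityˡ : ∀ a → 0v +v a ≡ a
  +v-identityˡ a = begin
    0v +v a             ≡⟨ cong (0v +v_) ([]-toℕ a) ⟨
    [ 0 ] +v [ toℕ a ]  ≡⟨ []-+ 0 (toℕ a) ⟩
    [ toℕ a ]           ≡⟨ []-toℕ a ⟩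
    a                   ∎

  *v-identityˡ : ∀ a → 1v *v a ≡ a
  *v-identityˡ a = begin
    1v *v a             ≡⟨ cong (1v *v_) ([]-toℕ a) ⟨
    [ 1 ] *v [ toℕ a ]  ≡⟨ []-* 1 (toℕ a) ⟩
    [ 1 * toℕ a ]       ≡⟨ cong [_] (*-identityˡ (toℕ a)) ⟩
    [ toℕ a ]           ≡⟨ []-toℕ a ⟩
    a                   ∎

  +v-inverseʳ : ∀ a → a +v (-v a) ≡ 0v
  +v-inverseʳ a = begin
    a +v [ v ∸ toℕ a ]              ≡⟨ cong (_+v [ v ∸ toℕ a ]) ([]-toℕ a) ⟨
    [ toℕ a ] +v [ v ∸ toℕ a ]      ≡⟨ []-+ _ _ ⟩
    [ toℕ a + (v ∸ toℕ a) ]         ≡⟨ cong [_] (m+[n∸m]≡n (<⇒≤ (toℕ<n a))) ⟩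
    [ v ]                           ≡⟨ [v]≡0 ⟩
    0v                              ∎

  isCommutativeRing : IsCommutativeRing _≡_ _+v_ _*v_ (λ a → -v a) 0v 1v
  isCommutativeRing = record
    { isRing = record
      { +-isAbelianGroup = record
        { isGroup = record
          { isMonoid = record
            { isSemigroup = record
              { isMagma = record { isEquivalence = isEquivalence ; ∙-cong = cong₂ _+v_ }
              ; assoc = +v-assoc }
            ; identity = +v-identityˡ , λ a → trans (+v-comm a 0v) (+v-identityˡ a) }
          ; inverse = (λ a → trans (+v-comm (-v a) a) (+v-inverseʳ a)) , +v-inverseʳ
          ; ⁻¹-cong = cong (λ z → -v z) }
        ; comm = +v-comm }
      ; *-cong = cong₂ _*v_
      ; *-assoc = *v-assoc
      ; *-identity = *v-identityˡ , λ a → trans (*v-comm a 1v) (*v-identityˡ a)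
      ; distrib = *v-distribˡ-+v , λ a b c →
          trans (*v-comm (b +v c) a) (trans (*v-distribˡ-+v a b c) (cong₂ _+v_ (*v-comm a b) (*v-comm a c))) }
    ; *-comm = *v-comm }

  commutativeRing : CommutativeRing 0ℓ 0ℓ
  commutativeRing = record { isCommutativeRing = isCommutativeRing }

  open CommutativeRing commutativeRing public using () renaming (zeroʳ to *v-zeroʳ; zeroˡ to *v-zeroˡ)
  open GroupProperties (CommutativeRing.+-group commutativeRing) public using ()
    renaming (x∙y⁻¹≈ε⇒x≈y to -v≡0⇒≡; ⁻¹-injective to -v-injective; inverseˡ-unique to inverseˡ-unique; x≈y⇒x∙y⁻¹≈ε to ≡⇒-v≡0; ε⁻¹≈ε to -v0≡0; ⁻¹-involutive to -v-involutive)
  open AbelianGroupProperties (CommutativeRing.+-abelianGroup commutativeRing) public using ()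
    renaming (⁻¹-∙-comm to -v-+v-comm; xyx⁻¹≈y to +v-+v-v-cancel)
  open RingProperties (CommutativeRing.ring commutativeRing) public using ()
    renaming (-‿distribˡ-* to -v-distribˡ-*v; -‿distribʳ-* to -v-distribʳ-*v)

  -- The ring solver below has integer coefficients, interpreted in ℤ_v through fromℤ.
  fromℤ : ℤ → ℤv
  fromℤ (+ n)      = [ n ]
  fromℤ -[1+ n ]   = -v [ suc n ]

  private
    signed : Sign → ℤv → ℤv
    signed Sign.+ x = x
    signed Sign.- x = -v x

    fromℤ-◃ : ∀ s n → fromℤ (s ℤ.◃ n) ≡ signed s [ n ]
    fromℤ-◃ Sign.+ zero    = refl
    fromℤ-◃ Sign.- zero    = sym -v0≡0
    fromℤ-◃ Sign.+ (suc n) = refl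
    fromℤ-◃ Sign.- (suc n) = refl

    fromℤ-sign : ∀ i → fromℤ i ≡ signed (ℤ.sign i) [ ℤ.∣ i ∣ ]
    fromℤ-sign i = trans (cong fromℤ (sym (ℤP.◃-inverse i))) (fromℤ-◃ (ℤ.sign i) ℤ.∣ i ∣)

    signed-* : ∀ s t x y → signed (s Sign.* t) (x *v y) ≡ signed s x *v signed t y
    signed-* Sign.+ Sign.+ x y = refl
    signed-* Sign.+ Sign.- x y = -v-distribʳ-*v x y
    signed-* Sign.- Sign.+ x y = -v-distribˡ-*v x y
    signed-* Sign.- Sign.- x y = begin
      x *v y              ≡⟨ -v-involutive (x *v y) ⟨
      -v (-v (x *v y))    ≡⟨ cong (λ z → -v z) (-v-distribʳ-*v x y) ⟩
      -v (x *v (-v y))    ≡⟨ -v-distribˡ-*v x (-v y) ⟩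
      (-v x) *v (-v y)    ∎

    fromℤ-⊖ : ∀ m n → fromℤ (m ℤ.⊖ n) ≡ [ m ] -v [ n ]
    fromℤ-⊖ m       zero    = sym (trans (cong ([ m ] +v_) -v0≡0) (trans (+v-comm _ 0v) (+v-identityˡ _)))
    fromℤ-⊖ zero    (suc n) = sym (+v-identityˡ _)
    fromℤ-⊖ (suc m) (suc n) = begin
      fromℤ (suc m ℤ.⊖ suc n)                    ≡⟨ cong fromℤ (ℤP.[1+m]⊖[1+n]≡m⊖n m n) ⟩
      fromℤ (m ℤ.⊖ n)                            ≡⟨ fromℤ-⊖ m n ⟩
      [ m ] +v -v [ n ]                          ≡⟨ cong (_+v -v [ n ]) (+v-+v-v-cancel 1v [ m ]) ⟨
      (1v +v [ m ]) +v -v 1v +v -v [ n ]         ≡⟨ +v-assoc (1v +v [ m ]) (-v 1v) (-v [ n ]) ⟩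
      (1v +v [ m ]) +v (-v 1v +v -v [ n ])       ≡⟨ cong₂ _+v_ ([]-+ 1 m) (-v-+v-comm 1v [ n ]) ⟩
      [ suc m ] +v -v (1v +v [ n ])              ≡⟨ cong (λ z → [ suc m ] -v z) ([]-+ 1 n) ⟩
      [ suc m ] -v [ suc n ]                     ∎

  fromℤ-+ : ∀ i j → fromℤ (i ℤ.+ j) ≡ fromℤ i +v fromℤ j
  fromℤ-+ (+ m)    (+ n)    = sym ([]-+ m n)
  fromℤ-+ (+ m)    -[1+ n ] = fromℤ-⊖ m (suc n)
  fromℤ-+ -[1+ m ] (+ n)    = trans (fromℤ-⊖ n (suc m)) (+v-comm [ n ] (-v [ suc m ]))
  fromℤ-+ -[1+ m ] -[1+ n ] = begin
    -v [ suc (suc (m + n)) ]       ≡⟨ cong (λ k → -v [ suc k ]) (+-suc m n) ⟨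
    -v [ suc m + suc n ]           ≡⟨ cong (λ z → -v z) ([]-+ (suc m) (suc n)) ⟨
    -v ([ suc m ] +v [ suc n ])    ≡⟨ -v-+v-comm [ suc m ] [ suc n ] ⟨
    -v [ suc m ] +v -v [ suc n ]   ∎

  fromℤ-* : ∀ i j → fromℤ (i ℤ.* j) ≡ fromℤ i *v fromℤ j
  fromℤ-* i j = begin
    fromℤ (i ℤ.* j)                                  ≡⟨ fromℤ-◃ s _ ⟩
    signed s [ ℤ.∣ i ∣ * ℤ.∣ j ∣ ]                   ≡⟨ cong (signed s) ([]-* _ _) ⟨
    signed s ([ ℤ.∣ i ∣ ] *v [ ℤ.∣ j ∣ ])            ≡⟨ signed-* (ℤ.sign i) (ℤ.sign j) _ _ ⟩
    signed (ℤ.sign i) [ ℤ.∣ i ∣ ] *v signed (ℤ.sign j) [ ℤ.∣ j ∣ ] ≡⟨ cong₂ _*v_ (fromℤ-sign i) (fromℤ-sign j) ⟨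
    fromℤ i *v fromℤ j                               ∎
    where s = ℤ.sign i Sign.* ℤ.sign j

  fromℤ-neg : ∀ i → fromℤ (ℤ.- i) ≡ -v fromℤ i
  fromℤ-neg (+ zero)  = sym -v0≡0
  fromℤ-neg (+ suc n) = refl
  fromℤ-neg -[1+ n ]  = sym (-v-involutive _)

  private
    fromℤ-morphism : ℤ.+-*-rawRing -Raw-AlmostCommutative⟶ fromCommutativeRing commutativeRing
    fromℤ-morphism = record
      { ⟦_⟧ = fromℤ ; +-homo = fromℤ-+ ; *-homo = fromℤ-* ; -‿homo = fromℤ-neg ; 0-homo = refl ; 1-homo = refl }

    fromℤ-≟ : ∀ i j → Maybe (fromℤ i ≡ fromℤ j)
    fromℤ-≟ i j with i ℤ.≟ j
    ... | yes i≡j = just (cong fromℤ i≡j)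
    ... | no  _   = nothing

  open RingSolver ℤ.+-*-rawRing (fromCommutativeRing commutativeRing) fromℤ-morphism fromℤ-≟ public
    using (solve; _:+_; _:*_; :-_; _:-_; con; _:=_; Polynomial)

  𝟘 𝟙 : ∀ {n} → Polynomial n
  𝟘 = con (+ 0)
  𝟙 = con (+ 1)

  ≡0-by-combination : ∀ {t E C} q₁ q₂ → t ≡ q₁ *v E +v q₂ *v C → E ≡ 0v → C ≡ 0v → t ≡ 0v
  ≡0-by-combination {t} q₁ q₂ t≡ refl refl =
    trans t≡ (solve 2 (λ a b → a :* 𝟘 :+ b :* 𝟘 := 𝟘) refl q₁ q₂)

  -v-+v-cancelʳ : ∀ x y → (x -v y) +v y ≡ x
  -v-+v-cancelʳ = solve 2 (λ x y → (x :- y) :+ y := x) refl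

  +v-identityʳ : ∀ x → x +v 0v ≡ x
  +v-identityʳ x = trans (+v-comm x 0v) (+v-identityˡ x)

  -v-identityʳ : ∀ x → x -v 0v ≡ x
  -v-identityʳ x = trans (cong (x +v_) -v0≡0) (+v-identityʳ x)

  Invertible : ℤv → Set
  Invertible c = ∃[ k ] k *v c ≡ 1v

  coprime⇒invertible : ∀ c → IsUnit c → Invertible c
  coprime⇒invertible c coprime with coprime-Bézout coprime
  ... | Bézout.+- x y 1+y*v≡x*c = [ x ] , (begin
    [ x ] *v c              ≡⟨ cong ([ x ] *v_) ([]-toℕ c) ⟨
    [ x ] *v [ toℕ c ]      ≡⟨ []-* x (toℕ c) ⟩
    [ x * toℕ c ]           ≡⟨ cong [_] 1+y*v≡x*c ⟨
    [ 1 + y * v ]           ≡⟨ []-+ 1 (y * v) ⟨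
    1v +v [ y * v ]         ≡⟨ cong (1v +v_) ([k*v]≡0 y) ⟩
    1v +v 0v                ≡⟨ +v-identityʳ 1v ⟩
    1v                      ∎)
  ... | Bézout.-+ x y 1+x*c≡y*v = -v [ x ] , (begin
    (-v [ x ]) *v c         ≡⟨ -v-distribˡ-*v [ x ] c ⟨
    -v ([ x ] *v c)         ≡⟨ inverseˡ-unique 1v ([ x ] *v c) 1+x*c≡0 ⟨
    1v                      ∎)
    where
    1+x*c≡0 : 1v +v [ x ] *v c ≡ 0v
    1+x*c≡0 = begin
      1v +v [ x ] *v c            ≡⟨ cong (λ z → 1v +v [ x ] *v z) ([]-toℕ c) ⟨
      [ 1 ] +v [ x ] *v [ toℕ c ] ≡⟨ cong (1v +v_) ([]-* x (toℕ c)) ⟩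
      [ 1 ] +v [ x * toℕ c ]      ≡⟨ []-+ 1 _ ⟩
      [ 1 + x * toℕ c ]           ≡⟨ cong [_] 1+x*c≡y*v ⟩
      [ y * v ]                   ≡⟨ [k*v]≡0 y ⟩
      0v                          ∎

  invertible⇒coprime : ∀ c → Invertible c → IsUnit c
  invertible⇒coprime c (k , k*c≡1) {d} (d∣c , d∣v) = ∣1⇒≡1 (∣n∧∣1%n⇒∣1 v d∣v (subst (d ∣_) kc%v≡1%v d∣kc%v))
    where
    d∣kc%v : d ∣ (toℕ k * toℕ c) % v
    d∣kc%v = %-presˡ-∣ (∣-trans d∣c (n∣m*n (toℕ k))) d∣v
    kc%v≡1%v : (toℕ k * toℕ c) % v ≡ 1 % v
    kc%v≡1%v = trans (sym (toℕ-[] _)) (trans (cong toℕ k*c≡1) (toℕ-[] 1))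

  invertible-1 : Invertible 1v
  invertible-1 = 1v , *v-identityˡ 1v

  invertible-neg : ∀ {c} → Invertible c → Invertible (-v c)
  invertible-neg {c} (k , k*c≡1) = -v k , trans (solve 2 (λ k c → (:- k) :* (:- c) := k :* c) refl k c) k*c≡1

  invertible-* : ∀ {a b} → Invertible a → Invertible b → Invertible (a *v b)
  invertible-* {a} {b} (k , k*a≡1) (k′ , k′*b≡1) = k *v k′ , (begin
    (k *v k′) *v (a *v b) ≡⟨ solve 4 (λ k k′ a b → (k :* k′) :* (a :* b) := (k :* a) :* (k′ :* b)) refl k k′ a b ⟩
    (k *v a) *v (k′ *v b) ≡⟨ cong₂ _*v_ k*a≡1 k′*b≡1 ⟩
    1v *v 1v              ≡⟨ *v-identityˡ 1v ⟩
    1v                    ∎)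

  *v-cancelˡ : ∀ {c a b} → Invertible c → c *v a ≡ c *v b → a ≡ b
  *v-cancelˡ {c} {a} {b} (k , k*c≡1) c*a≡c*b = begin
    a               ≡⟨ *v-identityˡ a ⟨
    1v *v a         ≡⟨ cong (_*v a) k*c≡1 ⟨
    (k *v c) *v a   ≡⟨ *v-assoc k c a ⟩
    k *v (c *v a)   ≡⟨ cong (k *v_) c*a≡c*b ⟩
    k *v (c *v b)   ≡⟨ *v-assoc k c b ⟨
    (k *v c) *v b   ≡⟨ cong (_*v b) k*c≡1 ⟩
    1v *v b         ≡⟨ *v-identityˡ b ⟩
    b               ∎

  invertible-*≡0 : ∀ {c a} → Invertible c → c *v a ≡ 0v → a ≡ 0v
  invertible-*≡0 {c} c-inv c*a≡0 = *v-cancelˡ c-inv (trans c*a≡0 (sym (*v-zeroʳ c)))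

  invertible⇒≢0 : ∀ {c} → 1v ≢ 0v → Invertible c → c ≢ 0v
  invertible⇒≢0 1≢0 (k , k*c≡1) refl = 1≢0 (trans (sym k*c≡1) (*v-zeroʳ k))

  ^v-2 : ∀ a → a ^v 2 ≡ a *v a
  ^v-2 a = cong (λ n → [ toℕ a * n ]) (*-identityʳ (toℕ a))

  ^v-3 : ∀ a → a ^v 3 ≡ a *v a *v a
  ^v-3 a = begin
    [ toℕ a * (toℕ a * (toℕ a * 1)) ] ≡⟨ cong (λ n → [ toℕ a * (toℕ a * n) ]) (*-identityʳ (toℕ a)) ⟩
    [ toℕ a * (toℕ a * toℕ a) ]       ≡⟨ cong [_] (*-assoc (toℕ a) _ _) ⟨
    [ toℕ a * toℕ a * toℕ a ]         ≡⟨ []-* (toℕ a * toℕ a) (toℕ a) ⟨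
    (a *v a) *v [ toℕ a ]             ≡⟨ cong ((a *v a) *v_) ([]-toℕ a) ⟩
    a *v a *v a                       ∎

  Spans : Subset v → Set
  Spans X = ∀ z → InSpan (InDiff X) z

  InSpan⇒ : ∀ {D} (Q : ℤv → Set) → Q 0v → (∀ {a b} → Q a → Q b → Q (a +v b)) → (∀ {a} → Q a → Q (-v a)) →
            (∀ {d} → D d → Q d) → ∀ {z} → InSpan D z → Q z
  InSpan⇒ Q q0 q+ q- qD span-0         = q0
  InSpan⇒ Q q0 q+ q- qD (span-gen d)   = qD d
  InSpan⇒ Q q0 q+ q- qD (span-+ s t)   = q+ (InSpan⇒ Q q0 q+ q- qD s) (InSpan⇒ Q q0 q+ q- qD t)
  InSpan⇒ Q q0 q+ q- qD (span-neg s)   = q- (InSpan⇒ Q q0 q+ q- qD s)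

  Spans-triple⇒ : ∀ {a b} (Q : ℤv → Set) → Q 0v → (∀ {a b} → Q a → Q b → Q (a +v b)) → (∀ {a} → Q a → Q (-v a)) →
                  Q a → Q b → Spans (triple 0v a b) → ∀ z → Q z
  Spans-triple⇒ {a} {b} Q q0 q+ q- qa qb spans z = InSpan⇒ Q q0 q+ q- q-diff (spans z)
    where
    q-elem : ∀ {y} → y ∈ₛ triple 0v a b → Q y
    q-elem y∈ with ∈-triple⁻ y∈
    ... | inj₁ refl        = q0
    ... | inj₂ (inj₁ refl) = qa
    ... | inj₂ (inj₂ refl) = qb
    q-diff : ∀ {d} → InDiff (triple 0v a b) d → Q d
    q-diff (_ , _ , x₁∈ , x₂∈ , refl) = q+ (q-elem x₁∈) (q- (q-elem x₂∈))

  Multiple : ℤv → ℤv → Set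
  Multiple c y = ∃[ k ] y ≡ c *v k

  Spans-multiples⇒invertible : ∀ {a b c} → Multiple c a → Multiple c b → Spans (triple 0v a b) → Invertible c
  Spans-multiples⇒invertible {a} {b} {c} c∣a c∣b spans = invertible (Spans-triple⇒ (Multiple c) c∣0 c∣+ c∣- c∣a c∣b spans 1v)
    where
    invertible : Multiple c 1v → Invertible c
    invertible (k , 1≡c*k) = k , trans (*v-comm k c) (sym 1≡c*k)
    c∣0 : Multiple c 0v
    c∣0 = 0v , sym (*v-zeroʳ c)
    c∣+ : ∀ {y z} → Multiple c y → Multiple c z → Multiple c (y +v z)
    c∣+ (k₁ , refl) (k₂ , refl) = k₁ +v k₂ , sym (*v-distribˡ-+v c k₁ k₂)
    c∣- : ∀ {y} → Multiple c y → Multiple c (-v y)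
    c∣- (k , refl) = -v k , -v-distribʳ-*v c k

  Spans-annihilated⇒≡0 : ∀ {a b} m → m *v a ≡ 0v → m *v b ≡ 0v → Spans (triple 0v a b) → m ≡ 0v
  Spans-annihilated⇒≡0 {a} {b} m m*a≡0 m*b≡0 spans =
    trans (sym (trans (*v-comm m 1v) (*v-identityˡ m))) (Spans-triple⇒ Q (*v-zeroʳ m) q+ q- m*a≡0 m*b≡0 spans 1v)
    where
    Q : ℤv → Set
    Q y = m *v y ≡ 0v
    q+ : ∀ {y z} → Q y → Q z → Q (y +v z)
    q+ {y} {z} m*y≡0 m*z≡0 = trans (*v-distribˡ-+v m y z) (trans (cong₂ _+v_ m*y≡0 m*z≡0) (+v-identityˡ 0v))
    q- : ∀ {y} → Q y → Q (-v y)
    q- {y} m*y≡0 = trans (sym (-v-distribʳ-*v m y)) (trans (cong (λ z → -v z) m*y≡0) -v0≡0)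

  private
    InSpan-[n]* : ∀ {D g} → InSpan D g → ∀ n → InSpan D ([ n ] *v g)
    InSpan-[n]* {D} {g} g∈ zero    = subst (InSpan D) (sym (*v-zeroˡ g)) span-0
    InSpan-[n]* {D} {g} g∈ (suc n) = subst (InSpan D) (sym [1+n]*g≡g+[n]*g) (span-+ g∈ (InSpan-[n]* g∈ n))
      where
      [1+n]*g≡g+[n]*g : [ suc n ] *v g ≡ g +v [ n ] *v g
      [1+n]*g≡g+[n]*g = trans (cong (_*v g) (sym ([]-+ 1 n)))
                              (solve 2 (λ x g → (𝟙 :+ x) :* g := g :+ x :* g) refl [ n ] g)

  invertible∈span⇒spans : ∀ {D g} → Invertible g → InSpan D g → ∀ z → InSpan D z
  invertible∈span⇒spans {D} {g} (k , k*g≡1) g∈ z = subst (InSpan D) [z*k]*g≡z (InSpan-[n]* g∈ (toℕ (z *v k)))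
    where
    [z*k]*g≡z : [ toℕ (z *v k) ] *v g ≡ z
    [z*k]*g≡z = begin
      [ toℕ (z *v k) ] *v g ≡⟨ cong (_*v g) ([]-toℕ (z *v k)) ⟩
      (z *v k) *v g         ≡⟨ *v-assoc z k g ⟩
      z *v (k *v g)         ≡⟨ cong (z *v_) k*g≡1 ⟩
      z *v 1v               ≡⟨ *v-comm z 1v ⟩
      1v *v z               ≡⟨ *v-identityˡ z ⟩
      z                     ∎

  x²+x+1≡0⇒x³≡1 : ∀ {x} → x *v x +v x +v 1v ≡ 0v → x *v x *v x ≡ 1v
  x²+x+1≡0⇒x³≡1 {x} x²+x+1≡0 = -v≡0⇒≡ _ _ (≡0-by-combination (x -v 1v) 0v
    (solve 1 (λ x → x :* x :* x :- 𝟙 := (x :- 𝟙) :* (x :* x :+ x :+ 𝟙) :+ 𝟘 :* (x :* x :+ x :+ 𝟙)) refl x) x²+x+1≡0 x²+x+1≡0)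

  -v≢0 : ∀ {x} → x ≢ 0v → -v x ≢ 0v
  -v≢0 {x} x≢0 -x≡0 = x≢0 (trans (sym (-v-involutive x)) (trans (cong (λ z → -v z) -x≡0) -v0≡0))

  2≢0⇒1≢0 : 1v +v 1v ≢ 0v → 1v ≢ 0v
  2≢0⇒1≢0 2≢0 1≡0 = 2≢0 (trans (cong₂ _+v_ 1≡0 1≡0) (+v-identityˡ 0v))

  ≢0-by-≡ : ∀ {x y} → x ≡ y → y ≢ 0v → x ≢ 0v
  ≢0-by-≡ x≡y y≢0 x≡0 = y≢0 (trans (sym x≡y) x≡0)

  ≢0-by-≡-v : ∀ {x y} → x ≡ -v y → y ≢ 0v → x ≢ 0v
  ≢0-by-≡-v {x} {y} x≡-y y≢0 x≡0 = y≢0 (trans (sym (-v-involutive y)) (trans (cong (λ z → -v z) (trans (sym x≡-y) x≡0)) -v0≡0))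

  ≡-by-multiple : ∀ {x y E} q → x -v y ≡ q *v E → E ≡ 0v → x ≡ y
  ≡-by-multiple {x} {y} q x-y≡qE refl = -v≡0⇒≡ x y (trans x-y≡qE (*v-zeroʳ q))

  units : List ℤv
  units = filter (λ c → coprime? (toℕ c) v) (allFin v)

  Invertible⇒∈units : ∀ {c} → Invertible c → c ∈ units
  Invertible⇒∈units {c} c-inv = ∈-filter⁺ (λ c → coprime? (toℕ c) v) (∈-allFin c) (invertible⇒coprime c c-inv)

  ∈units⇒Invertible : ∀ {c} → c ∈ units → Invertible c
  ∈units⇒Invertible {c} c∈ = coprime⇒invertible c (proj₂ (∈-filter⁻ (λ c → coprime? (toℕ c) v) {xs = allFin v} c∈))

  Unique-units : Unique units
  Unique-units = Unique.filter⁺ (λ c → coprime? (toℕ c) v) (Unique.allFin⁺ v)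

  length-units : length units ≡ φ v
  length-units = sym (trans (cong (λ xs → length (filter (λ k → coprime? k v) xs)) (sym (map-toℕ-allFin v)))
                            (length-filter-map (λ k → coprime? k v) toℕ (allFin v)))

module Differences (v : ℕ) .{{_ : NonZero v}} where
  open ℤmod v
  open Residues v

  differences : ℤv → ℤv → List ℤv
  differences a b = 0v ∷ a ∷ b ∷ -v a ∷ -v b ∷ a -v b ∷ b -v a ∷ []

  InDiff-triple⇒∈ : ∀ {a b d} → InDiff (triple 0v a b) d → d ∈ differences a b
  InDiff-triple⇒∈ {a} {b} (_ , _ , x₁∈ , x₂∈ , refl) = diff (∈-triple⁻ x₁∈) (∈-triple⁻ x₂∈)
    where
    diff : ∀ {x₁ x₂} → OneOf x₁ 0v a b → OneOf x₂ 0v a b → x₁ -v x₂ ∈ differences a b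
    diff (inj₁ refl)        (inj₁ refl)        = here (+v-inverseʳ 0v)
    diff (inj₁ refl)        (inj₂ (inj₁ refl)) = there (there (there (here (+v-identityˡ (-v a)))))
    diff (inj₁ refl)        (inj₂ (inj₂ refl)) = there (there (there (there (here (+v-identityˡ (-v b))))))
    diff (inj₂ (inj₁ refl)) (inj₁ refl)        = there (here (-v-identityʳ a))
    diff (inj₂ (inj₁ refl)) (inj₂ (inj₁ refl)) = here (+v-inverseʳ a)
    diff (inj₂ (inj₁ refl)) (inj₂ (inj₂ refl)) = there (there (there (there (there (here refl)))))
    diff (inj₂ (inj₂ refl)) (inj₁ refl)        = there (there (here (-v-identityʳ b)))
    diff (inj₂ (inj₂ refl)) (inj₂ (inj₁ refl)) = there (there (there (there (there (there (here refl))))))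
    diff (inj₂ (inj₂ refl)) (inj₂ (inj₂ refl)) = here (+v-inverseʳ b)

  ∈⇒InDiff-triple : ∀ {a b d} → d ∈ differences a b → InDiff (triple 0v a b) d
  ∈⇒InDiff-triple {a} {b} (here refl) = 0v , 0v , 0∈ , 0∈ , +v-inverseʳ 0v
    where 0∈ = ∈-triple⁺ (inj₁ refl)
  ∈⇒InDiff-triple {a} {b} (there (here refl)) =
    a , 0v , ∈-triple⁺ (inj₂ (inj₁ refl)) , ∈-triple⁺ (inj₁ refl) , -v-identityʳ a
  ∈⇒InDiff-triple {a} {b} (there (there (here refl))) =
    b , 0v , ∈-triple⁺ (inj₂ (inj₂ refl)) , ∈-triple⁺ (inj₁ refl) , -v-identityʳ b
  ∈⇒InDiff-triple {a} {b} (there (there (there (here refl)))) =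
    0v , a , ∈-triple⁺ (inj₁ refl) , ∈-triple⁺ (inj₂ (inj₁ refl)) , +v-identityˡ (-v a)
  ∈⇒InDiff-triple {a} {b} (there (there (there (there (here refl))))) =
    0v , b , ∈-triple⁺ (inj₁ refl) , ∈-triple⁺ (inj₂ (inj₂ refl)) , +v-identityˡ (-v b)
  ∈⇒InDiff-triple {a} {b} (there (there (there (there (there (here refl)))))) =
    a , b , ∈-triple⁺ (inj₂ (inj₁ refl)) , ∈-triple⁺ (inj₂ (inj₂ refl)) , refl
  ∈⇒InDiff-triple {a} {b} (there (there (there (there (there (there (here refl))))))) =
    b , a , ∈-triple⁺ (inj₂ (inj₂ refl)) , ∈-triple⁺ (inj₂ (inj₁ refl)) , refl

  differences-scale : ∀ c α β → map (c *v_) (differences α β) ≡ differences (c *v α) (c *v β)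
  differences-scale c α β = cong₂ _∷_ (*v-zeroʳ c) (cong (c *v α ∷_) (cong (c *v β ∷_)
    (cong₂ _∷_ (neg α) (cong₂ _∷_ (neg β)
    (cong₂ _∷_ (solve 3 (λ c a b → c :* (a :- b) := c :* a :- c :* b) refl c α β)
    (cong₂ _∷_ (solve 3 (λ c a b → c :* (b :- a) := c :* b :- c :* a) refl c α β) refl))))))
    where
    neg : ∀ a → c *v (-v a) ≡ -v (c *v a)
    neg = solve 2 (λ c a → c :* (:- a) := :- (c :* a)) refl c

  -- The nine conditions say exactly that the seven entries of differences α β are distinct;
  -- invertibility of α makes them generate ℤ_v.
  record Admissible (α β : ℤv) : Set where
    field
      α-invertible : Invertible α
      β≢0          : β ≢ 0v
      α-β≢0        : α -v β ≢ 0v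
      2α≢0         : α +v α ≢ 0v
      2β≢0         : β +v β ≢ 0v
      α+β≢0        : α +v β ≢ 0v
      2α-β≢0       : α +v α -v β ≢ 0v
      2β-α≢0       : β +v β -v α ≢ 0v
      2[α-β]≢0     : (α -v β) +v (α -v β) ≢ 0v

    α≢0 : α ≢ 0v
    α≢0 α≡0 = β≢0 (begin
      β              ≡⟨ *v-identityˡ β ⟨
      1v *v β        ≡⟨ cong (_*v β) (proj₂ α-invertible) ⟨
      (k *v α) *v β  ≡⟨ cong (λ a → (k *v a) *v β) α≡0 ⟩
      (k *v 0v) *v β ≡⟨ cong (_*v β) (*v-zeroʳ k) ⟩
      0v *v β        ≡⟨ *v-zeroˡ β ⟩
      0v             ∎)
      where k = proj₁ α-invertible

  private
    ≢-by : ∀ {x y P} → x -v y ≡ P → P ≢ 0v → x ≢ y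
    ≢-by {x} {y} x-y≡P P≢0 x≡y = P≢0 (trans (sym x-y≡P) (≡⇒-v≡0 x≡y))

    ≢-by-neg : ∀ {x y P} → x -v y ≡ -v P → P ≢ 0v → x ≢ y
    ≢-by-neg x-y≡-P P≢0 = ≢-by x-y≡-P (-v≢0 P≢0)

  Unique-differences : ∀ {α β} → Admissible α β → Unique (differences α β)
  Unique-differences {α} {β} adm =
    ( ≢-by-neg (+v-identityˡ _) α≢0 ∷ ≢-by-neg (+v-identityˡ _) β≢0
    ∷ ≢-by (+v-identityˡ _) (-v≢0 (-v≢0 α≢0)) ∷ ≢-by (+v-identityˡ _) (-v≢0 (-v≢0 β≢0))
    ∷ ≢-by-neg (+v-identityˡ _) α-β≢0
    ∷ ≢-by-neg (trans (+v-identityˡ _) (cong (λ z → -v z) (solve 2 (λ a b → b :- a := :- (a :- b)) refl α β))) (-v≢0 α-β≢0) ∷ [])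
    ∷ ( ≢-by (solve 2 (λ a b → a :- b := a :- b) refl α β) α-β≢0 ∷ ≢-by (solve 2 (λ a b → a :- (:- a) := a :+ a) refl α β) 2α≢0
      ∷ ≢-by (solve 2 (λ a b → a :- (:- b) := a :+ b) refl α β) α+β≢0 ∷ ≢-by (solve 2 (λ a b → a :- (a :- b) := b) refl α β) β≢0
      ∷ ≢-by (solve 2 (λ a b → a :- (b :- a) := a :+ a :- b) refl α β) 2α-β≢0 ∷ [])
    ∷ ( ≢-by (solve 2 (λ a b → b :- (:- a) := a :+ b) refl α β) α+β≢0 ∷ ≢-by (solve 2 (λ a b → b :- (:- b) := b :+ b) refl α β) 2β≢0
      ∷ ≢-by (solve 2 (λ a b → b :- (a :- b) := b :+ b :- a) refl α β) 2β-α≢0 ∷ ≢-by (solve 2 (λ a b → b :- (b :- a) := a) refl α β) α≢0 ∷ [])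
    ∷ ( ≢-by-neg (solve 2 (λ a b → (:- a) :- (:- b) := :- (a :- b)) refl α β) α-β≢0
      ∷ ≢-by-neg (solve 2 (λ a b → (:- a) :- (a :- b) := :- (a :+ a :- b)) refl α β) 2α-β≢0
      ∷ ≢-by-neg (solve 2 (λ a b → (:- a) :- (b :- a) := :- b) refl α β) β≢0 ∷ [])
    ∷ ( ≢-by-neg (solve 2 (λ a b → (:- b) :- (a :- b) := :- a) refl α β) α≢0
      ∷ ≢-by-neg (solve 2 (λ a b → (:- b) :- (b :- a) := :- (b :+ b :- a)) refl α β) 2β-α≢0 ∷ [])
    ∷ (≢-by (solve 2 (λ a b → (a :- b) :- (b :- a) := (a :- b) :+ (a :- b)) refl α β) 2[α-β]≢0 ∷ [])
    ∷ [] ∷ []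
    where open Admissible adm

  triple-InBcon3 : ∀ {c α β} → Invertible c → Admissible α β → InBcon3 (triple 0v (c *v α) (c *v β))
  triple-InBcon3 {c} {α} {β} c-inv adm =
    ∣triple∣≡3 (0≢c* α≢0) (0≢c* β≢0) (λ cα≡cβ → α-β≢0 (≡⇒-v≡0 (*v-cancelˡ c-inv cα≡cβ))) ,
    ( differences (c *v α) (c *v β)
    , subst Unique (differences-scale c α β) (Unique.map⁺ (*v-cancelˡ c-inv) (Unique-differences adm))
    , (λ d → mk⇔ ∈⇒InDiff-triple InDiff-triple⇒∈)
    , refl) ,
    invertible∈span⇒spans (invertible-* c-inv α-invertible) (span-gen (∈⇒InDiff-triple (there (here refl))))
    where
    open Admissible adm
    0≢c* : ∀ {x} → x ≢ 0v → 0v ≢ c *v x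
    0≢c* x≢0 0≡cx = x≢0 (invertible-*≡0 c-inv (sym 0≡cx))

  repeated-difference⇒¬Count7 : ∀ {a b x} (p : x ∈ differences a b) → x ∈ differences a b ─ p →
                                  ¬ CountIs (InDiff (triple 0v a b)) 7
  repeated-difference⇒¬Count7 p x∈rest (ds , unique , ds⇔ , length≡7) =
    <-irrefl length≡7 (Unique-⊆-repeat⇒length< unique (InDiff-triple⇒∈ ∘ Equivalence.to (ds⇔ _)) p x∈rest)

module Scaling (v : ℕ) .{{_ : NonZero v}} (l : ℤmod.ℤv v)
               (l-invertible : Residues.Invertible v l) (l≢1 : l ≢ ℤmod.1v v) where
  open ℤmod v
  open Residues v
  open Differences v

  l-1≢0 : l -v 1v ≢ 0v
  l-1≢0 l-1≡0 = l≢1 (-v≡0⇒≡ l 1v l-1≡0)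

  affine : ℤv → ℤv → ℤv
  affine x y = l *v y +v x

  affine-0 : ∀ x → affine x 0v ≡ x
  affine-0 x = trans (cong (_+v x) (*v-zeroʳ l)) (+v-identityˡ x)

  affine-injective : ∀ {x y y′} → affine x y ≡ affine x y′ → y ≡ y′
  affine-injective {x} {y} {y′} eq = *v-cancelˡ l-invertible (begin
    l *v y               ≡⟨ solve 2 (λ a x → a := (a :+ x) :- x) refl (l *v y) x ⟩
    affine x y -v x      ≡⟨ cong (_-v x) eq ⟩
    affine x y′ -v x     ≡⟨ solve 2 (λ a x → (a :+ x) :- x := a) refl (l *v y′) x ⟩
    l *v y′              ∎)

  affine-closed : ∀ {X x y} → ScaledEqShift l X x → y ∈ₛ X → affine x y ∈ₛ X
  affine-closed {X} {x} {y} lX≡X-x y∈X with Equivalence.to (lX≡X-x (l *v y)) (y , y∈X , refl)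
  ... | x′ , x′∈X , ly≡x′-x = subst (_∈ₛ X) (sym (trans (cong (_+v x) ly≡x′-x) (-v-+v-cancelʳ x′ x))) x′∈X

  A B T : ℤv → Subset v
  A c = triple 0v c (l *v c)
  B c = triple 0v (-v c) ((l -v 1v) *v c)
  T c = triple 0v c ((1v +v l) *v c)

  Shape : Subset v → Set
  Shape X = (∃[ c ] Invertible c × l *v l ≡ 1v × X ≡ A c)
          ⊎ (∃[ c ] Invertible c × l *v l ≡ 1v × X ≡ B c)
          ⊎ (∃[ c ] Invertible c × l *v l +v l +v 1v ≡ 0v × X ≡ T c)

  affine-fixes-both⇒⊥ : ∀ {a b x} → x ≡ 0v → affine x a ≡ a → affine x b ≡ b → ¬ Spans (triple 0v a b)
  affine-fixes-both⇒⊥ {a} {b} refl fixes-a fixes-b spans =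
    l-1≢0 (Spans-annihilated⇒≡0 (l -v 1v) (annihilates fixes-a) (annihilates fixes-b) spans)
    where
    annihilates : ∀ {y} → affine 0v y ≡ y → (l -v 1v) *v y ≡ 0v
    annihilates {y} fixes-y = begin
      (l -v 1v) *v y     ≡⟨ solve 2 (λ l y → (l :- 𝟙) :* y := (l :* y :+ 𝟘) :- y) refl l y ⟩
      affine 0v y -v y   ≡⟨ cong (_-v y) fixes-y ⟩
      y -v y             ≡⟨ +v-inverseʳ y ⟩
      0v                 ∎

  affine-swaps⇒A : ∀ {a b x} → x ≡ 0v → affine x a ≡ b → affine x b ≡ a → Spans (triple 0v a b) →
                   Invertible a × l *v l ≡ 1v × triple 0v a b ≡ A a
  affine-swaps⇒A {a} {b} refl a↦b b↦a spans = a-invertible , l²≡1 , cong (triple 0v a) b≡la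
    where
    b≡la : b ≡ l *v a
    b≡la = trans (sym a↦b) (+v-identityʳ (l *v a))
    a-invertible : Invertible a
    a-invertible = Spans-multiples⇒invertible (1v , sym (trans (*v-comm a 1v) (*v-identityˡ a)))
                                              (l , trans b≡la (*v-comm l a)) spans
    l²≡1 : l *v l ≡ 1v
    l²≡1 = *v-cancelˡ a-invertible (begin
      a *v (l *v l)            ≡⟨ solve 2 (λ a l → a :* (l :* l) := l :* (l :* a) :+ 𝟘) refl a l ⟩
      affine 0v (l *v a)       ≡⟨ cong (affine 0v) b≡la ⟨
      affine 0v b              ≡⟨ b↦a ⟩
      a                        ≡⟨ trans (*v-comm a 1v) (*v-identityˡ a) ⟨
      a *v 1v                  ∎)

  affine-fixes-one⇒B : ∀ {a b x} → affine x a ≡ a → x ≡ b → affine x b ≡ 0v → Spans (triple 0v a b) →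
                       Invertible (-v a) × l *v l ≡ 1v × triple 0v a b ≡ B (-v a)
  affine-fixes-one⇒B {a} {b} {x} a↦a refl b↦0 spans =
    invertible-neg a-invertible , l²≡1 ,
    cong₂ (triple 0v) (sym (-v-involutive a)) (trans x≡a[1-l] (solve 2 (λ a l → a :* (𝟙 :- l) := (l :- 𝟙) :* (:- a)) refl a l))
    where
    x≡a[1-l] : x ≡ a *v (1v -v l)
    x≡a[1-l] = begin
      x                     ≡⟨ solve 2 (λ x y → x := (y :+ x) :- y) refl x (l *v a) ⟩
      affine x a -v l *v a  ≡⟨ cong (_-v l *v a) a↦a ⟩
      a -v l *v a           ≡⟨ solve 2 (λ a l → a :- l :* a := a :* (𝟙 :- l)) refl a l ⟩
      a *v (1v -v l)        ∎
    a-invertible : Invertible a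
    a-invertible = Spans-multiples⇒invertible (1v , sym (trans (*v-comm a 1v) (*v-identityˡ a))) (1v -v l , x≡a[1-l]) spans
    l²≡1 : l *v l ≡ 1v
    l²≡1 = sym (-v≡0⇒≡ 1v (l *v l) (invertible-*≡0 a-invertible (begin
      a *v (1v -v l *v l)                           ≡⟨ solve 2 (λ a l → a :* (𝟙 :- l :* l) := l :* (a :* (𝟙 :- l)) :+ a :* (𝟙 :- l)) refl a l ⟩
      l *v (a *v (1v -v l)) +v a *v (1v -v l)       ≡⟨ cong (λ z → l *v z +v z) x≡a[1-l] ⟨
      affine x x                                    ≡⟨ b↦0 ⟩
      0v                                            ∎)))

  affine-cycles⇒T : ∀ {a b x} → x ≡ a → affine x a ≡ b → affine x b ≡ 0v → Spans (triple 0v a b) →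
                    Invertible a × l *v l +v l +v 1v ≡ 0v × triple 0v a b ≡ T a
  affine-cycles⇒T {a} {b} refl a↦b b↦0 spans = a-invertible , cyclotomic , cong (triple 0v a) b≡[1+l]a
    where
    b≡[1+l]a : b ≡ (1v +v l) *v a
    b≡[1+l]a = trans (sym a↦b) (solve 2 (λ l a → l :* a :+ a := (𝟙 :+ l) :* a) refl l a)
    a-invertible : Invertible a
    a-invertible = Spans-multiples⇒invertible (1v , sym (trans (*v-comm a 1v) (*v-identityˡ a)))
                                              (1v +v l , trans b≡[1+l]a (*v-comm (1v +v l) a)) spans
    cyclotomic : l *v l +v l +v 1v ≡ 0v
    cyclotomic = invertible-*≡0 a-invertible (begin
      a *v (l *v l +v l +v 1v)        ≡⟨ solve 2 (λ l a → a :* (l :* l :+ l :+ 𝟙) := l :* ((𝟙 :+ l) :* a) :+ a) refl l a ⟩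
      affine a ((1v +v l) *v a)       ≡⟨ cong (affine a) b≡[1+l]a ⟨
      affine a b                      ≡⟨ b↦0 ⟩
      0v                              ∎)

  private
    triple-Shape : ∀ {a b x} → 0v ≢ a → 0v ≢ b → a ≢ b → Spans (triple 0v a b) →
                   OneOf x 0v a b → OneOf (affine x a) 0v a b → OneOf (affine x b) 0v a b → Shape (triple 0v a b)
    triple-Shape {a} {b} {x} 0≢a 0≢b a≢b spans = cases
      where
      a↦x⇒⊥ : affine x a ≡ x → ⊥
      a↦x⇒⊥ eq = 0≢a (sym (affine-injective (trans eq (sym (affine-0 x)))))
      b↦x⇒⊥ : affine x b ≡ x → ⊥
      b↦x⇒⊥ eq = 0≢b (sym (affine-injective (trans eq (sym (affine-0 x)))))
      a,b↦same⇒⊥ : ∀ {z} → affine x a ≡ z → affine x b ≡ z → ⊥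
      a,b↦same⇒⊥ a↦z b↦z = a≢b (affine-injective (trans a↦z (sym b↦z)))
      spans′ : Spans (triple 0v b a)
      spans′ = subst Spans (triple-swap 0v a b) spans
      cases : OneOf x 0v a b → OneOf (affine x a) 0v a b → OneOf (affine x b) 0v a b → Shape (triple 0v a b)
      cases (inj₁ x≡0) (inj₁ a↦0) _ = ⊥-elim (a↦x⇒⊥ (trans a↦0 (sym x≡0)))
      cases (inj₁ x≡0) (inj₂ (inj₁ a↦a)) (inj₁ b↦0) = ⊥-elim (b↦x⇒⊥ (trans b↦0 (sym x≡0)))
      cases (inj₁ x≡0) (inj₂ (inj₁ a↦a)) (inj₂ (inj₁ b↦a)) = ⊥-elim (a,b↦same⇒⊥ a↦a b↦a)
      cases (inj₁ x≡0) (inj₂ (inj₁ a↦a)) (inj₂ (inj₂ b↦b)) = ⊥-elim (affine-fixes-both⇒⊥ x≡0 a↦a b↦b spans)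
      cases (inj₁ x≡0) (inj₂ (inj₂ a↦b)) (inj₁ b↦0) = ⊥-elim (b↦x⇒⊥ (trans b↦0 (sym x≡0)))
      cases (inj₁ x≡0) (inj₂ (inj₂ a↦b)) (inj₂ (inj₁ b↦a)) =
        let (a-inv , l²≡1 , X≡A) = affine-swaps⇒A x≡0 a↦b b↦a spans in inj₁ (a , a-inv , l²≡1 , X≡A)
      cases (inj₁ x≡0) (inj₂ (inj₂ a↦b)) (inj₂ (inj₂ b↦b)) = ⊥-elim (a,b↦same⇒⊥ a↦b b↦b)
      cases (inj₂ (inj₁ x≡a)) (inj₁ a↦0) (inj₁ b↦0) = ⊥-elim (a,b↦same⇒⊥ a↦0 b↦0)
      cases (inj₂ (inj₁ x≡a)) (inj₁ a↦0) (inj₂ (inj₁ b↦a)) = ⊥-elim (b↦x⇒⊥ (trans b↦a (sym x≡a)))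
      cases (inj₂ (inj₁ x≡a)) (inj₁ a↦0) (inj₂ (inj₂ b↦b)) =
        let (-b-inv , l²≡1 , X≡B) = affine-fixes-one⇒B b↦b x≡a a↦0 spans′
        in inj₂ (inj₁ (-v b , -b-inv , l²≡1 , trans (triple-swap 0v a b) X≡B))
      cases (inj₂ (inj₁ x≡a)) (inj₂ (inj₁ a↦a)) _ = ⊥-elim (a↦x⇒⊥ (trans a↦a (sym x≡a)))
      cases (inj₂ (inj₁ x≡a)) (inj₂ (inj₂ a↦b)) (inj₁ b↦0) =
        let (a-inv , cyclotomic , X≡T) = affine-cycles⇒T x≡a a↦b b↦0 spans
        in inj₂ (inj₂ (a , a-inv , cyclotomic , X≡T))
      cases (inj₂ (inj₁ x≡a)) (inj₂ (inj₂ a↦b)) (inj₂ (inj₁ b↦a)) = ⊥-elim (b↦x⇒⊥ (trans b↦a (sym x≡a)))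
      cases (inj₂ (inj₁ x≡a)) (inj₂ (inj₂ a↦b)) (inj₂ (inj₂ b↦b)) = ⊥-elim (a,b↦same⇒⊥ a↦b b↦b)
      cases (inj₂ (inj₂ x≡b)) (inj₁ a↦0) (inj₁ b↦0) = ⊥-elim (a,b↦same⇒⊥ a↦0 b↦0)
      cases (inj₂ (inj₂ x≡b)) (inj₁ a↦0) (inj₂ (inj₁ b↦a)) =
        let (b-inv , cyclotomic , X≡T) = affine-cycles⇒T x≡b b↦a a↦0 spans′
        in inj₂ (inj₂ (b , b-inv , cyclotomic , trans (triple-swap 0v a b) X≡T))
      cases (inj₂ (inj₂ x≡b)) (inj₁ a↦0) (inj₂ (inj₂ b↦b)) = ⊥-elim (b↦x⇒⊥ (trans b↦b (sym x≡b)))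
      cases (inj₂ (inj₂ x≡b)) (inj₂ (inj₁ a↦a)) (inj₁ b↦0) =
        let (-a-inv , l²≡1 , X≡B) = affine-fixes-one⇒B a↦a x≡b b↦0 spans
        in inj₂ (inj₁ (-v a , -a-inv , l²≡1 , X≡B))
      cases (inj₂ (inj₂ x≡b)) (inj₂ (inj₁ a↦a)) (inj₂ (inj₁ b↦a)) = ⊥-elim (a,b↦same⇒⊥ a↦a b↦a)
      cases (inj₂ (inj₂ x≡b)) (inj₂ (inj₁ a↦a)) (inj₂ (inj₂ b↦b)) = ⊥-elim (b↦x⇒⊥ (trans b↦b (sym x≡b)))
      cases (inj₂ (inj₂ x≡b)) (inj₂ (inj₂ a↦b)) _ = ⊥-elim (a↦x⇒⊥ (trans a↦b (sym x≡b)))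

  NCond⇒Shape : ∀ {X} → NCond l X → Shape X
  NCond⇒Shape ((∣X∣≡3 , _ , spans) , 0∈X , x , x∈X , lX≡X-x)
    with a , b , refl , 0≢a , 0≢b , a≢b ← triple-decomposition ∣X∣≡3 0∈X
    = triple-Shape 0≢a 0≢b a≢b spans (∈-triple⁻ x∈X)
        (∈-triple⁻ (affine-closed lX≡X-x (∈-triple⁺ (inj₂ (inj₁ refl)))))
        (∈-triple⁻ (affine-closed lX≡X-x (∈-triple⁺ (inj₂ (inj₂ refl)))))

  module Involution (l²≡1 : l *v l ≡ 1v) where

    l²-1≡0 : l *v l -v 1v ≡ 0v
    l²-1≡0 = ≡⇒-v≡0 l²≡1

    l*[l*c]≡c : ∀ c → l *v (l *v c) ≡ c
    l*[l*c]≡c c = trans (sym (*v-assoc l l c)) (trans (cong (_*v c) l²≡1) (*v-identityˡ c))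

    ¬cyclotomic : l *v l +v l +v 1v ≢ 0v
    ¬cyclotomic cyclotomic = l-1≢0 (≡0-by-combination (l -v 1v) (-v l)
      (solve 1 (λ l → l :- 𝟙 := (l :- 𝟙) :* (l :* l :+ l :+ 𝟙) :+ (:- l) :* (l :* l :- 𝟙)) refl l) cyclotomic l²-1≡0)

    A≡A[l*] : ∀ c → A c ≡ A (l *v c)
    A≡A[l*] c = trans (triple-swap 0v c (l *v c)) (cong (triple 0v (l *v c)) (sym (l*[l*c]≡c c)))

    A-shift : ∀ c → ScaledEqShift l (A c) 0v
    A-shift c y = mk⇔ to from
      where
      to : InScaled l (A c) y → InShift (A c) 0v y
      to (x , x∈ , refl) with ∈-triple⁻ x∈
      ... | inj₁ refl        = 0v , ∈-triple₁ , trans (*v-zeroʳ l) (sym (-v-identityʳ 0v))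
      ... | inj₂ (inj₁ refl) = l *v c , ∈-triple₃ , sym (-v-identityʳ (l *v c))
      ... | inj₂ (inj₂ refl) = c , ∈-triple₂ , trans (l*[l*c]≡c c) (sym (-v-identityʳ c))
      from : InShift (A c) 0v y → InScaled l (A c) y
      from (x′ , x′∈ , refl) with ∈-triple⁻ x′∈
      ... | inj₁ refl        = 0v , ∈-triple₁ , trans (-v-identityʳ 0v) (sym (*v-zeroʳ l))
      ... | inj₂ (inj₁ refl) = l *v c , ∈-triple₃ , trans (-v-identityʳ c) (sym (l*[l*c]≡c c))
      ... | inj₂ (inj₂ refl) = c , ∈-triple₂ , -v-identityʳ (l *v c)

    B-shift : ∀ c → ScaledEqShift l (B c) ((l -v 1v) *v c)
    B-shift c y = mk⇔ to from
      where
      x = (l -v 1v) *v c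
      l*x≡0-x : l *v x ≡ 0v -v x
      l*x≡0-x = begin
        l *v ((l -v 1v) *v c)   ≡⟨ solve 2 (λ l c → l :* ((l :- 𝟙) :* c) := (l :* l) :* c :- l :* c) refl l c ⟩
        (l *v l) *v c -v l *v c ≡⟨ cong (λ z → z *v c -v l *v c) l²≡1 ⟩
        1v *v c -v l *v c       ≡⟨ solve 2 (λ l c → 𝟙 :* c :- l :* c := 𝟘 :- (l :- 𝟙) :* c) refl l c ⟩
        0v -v x                 ∎
      to : InScaled l (B c) y → InShift (B c) x y
      to (x₀ , x₀∈ , refl) with ∈-triple⁻ x₀∈
      ... | inj₁ refl        = x , ∈-triple₃ , trans (*v-zeroʳ l) (sym (+v-inverseʳ x))
      ... | inj₂ (inj₁ refl) = -v c , ∈-triple₂ , solve 2 (λ l c → l :* (:- c) := (:- c) :- (l :- 𝟙) :* c) refl l c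
      ... | inj₂ (inj₂ refl) = 0v , ∈-triple₁ , l*x≡0-x
      from : InShift (B c) x y → InScaled l (B c) y
      from (x′ , x′∈ , refl) with ∈-triple⁻ x′∈
      ... | inj₁ refl        = x , ∈-triple₃ , sym l*x≡0-x
      ... | inj₂ (inj₁ refl) = -v c , ∈-triple₂ , solve 2 (λ l c → (:- c) :- (l :- 𝟙) :* c := l :* (:- c)) refl l c
      ... | inj₂ (inj₂ refl) = 0v , ∈-triple₁ , trans (+v-inverseʳ x) (sym (*v-zeroʳ l))

    -- When l = -1 or 2(l - 1) = 0, two of the seven differences of A c (and of B c) coincide.
    A-¬Count7 : ∀ c → l +v 1v ≡ 0v ⊎ (l -v 1v) +v (l -v 1v) ≡ 0v → ¬ CountIs (InDiff (A c)) 7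
    A-¬Count7 c (inj₁ l+1≡0) = repeated-difference⇒¬Count7 (there (there (here refl)))
      (there (there (here (≡-by-multiple c (solve 2 (λ l c → l :* c :- (:- c) := c :* (l :+ 𝟙)) refl l c) l+1≡0))))
    A-¬Count7 c (inj₂ 2[l-1]≡0) = repeated-difference⇒¬Count7 (there (there (there (there (there (here refl))))))
      (there (there (there (there (there (here (≡-by-multiple (-v c)
        (solve 2 (λ l c → (c :- l :* c) :- (l :* c :- c) := (:- c) :* ((l :- 𝟙) :+ (l :- 𝟙))) refl l c) 2[l-1]≡0)))))))

    B-¬Count7 : ∀ c → l +v 1v ≡ 0v ⊎ (l -v 1v) +v (l -v 1v) ≡ 0v → ¬ CountIs (InDiff (B c)) 7
    B-¬Count7 c (inj₁ l+1≡0) = repeated-difference⇒¬Count7 (there (there (there (there (there (here refl))))))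
      (there (there (there (here (≡-by-multiple (-v c)
        (solve 2 (λ l c → ((:- c) :- (l :- 𝟙) :* c) :- (:- (:- c)) := (:- c) :* (l :+ 𝟙)) refl l c) l+1≡0)))))
    B-¬Count7 c (inj₂ 2[l-1]≡0) = repeated-difference⇒¬Count7 (there (there (there (there (here refl)))))
      (there (there (here (≡-by-multiple (-v c)
        (solve 2 (λ l c → (:- ((l :- 𝟙) :* c)) :- (l :- 𝟙) :* c := (:- c) :* ((l :- 𝟙) :+ (l :- 𝟙))) refl l c) 2[l-1]≡0))))

    degenerate⇒¬NCond : l +v 1v ≡ 0v ⊎ (l -v 1v) +v (l -v 1v) ≡ 0v → ∀ X → ¬ NCond l X
    degenerate⇒¬NCond degenerate X ncond@((_ , count7 , _) , _) with NCond⇒Shape ncond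
    ... | inj₁ (c , _ , _ , refl)        = A-¬Count7 c degenerate count7
    ... | inj₂ (inj₁ (c , _ , _ , refl)) = B-¬Count7 c degenerate count7
    ... | inj₂ (inj₂ (_ , _ , cyclotomic , _)) = ¬cyclotomic cyclotomic

    module Nondegenerate (2≢0 : 1v +v 1v ≢ 0v) (l+1≢0 : l +v 1v ≢ 0v)
                         (2[l-1]≢0 : (l -v 1v) +v (l -v 1v) ≢ 0v) where

      1≢0 : 1v ≢ 0v
      1≢0 = 2≢0⇒1≢0 2≢0

      l≢0 : l ≢ 0v
      l≢0 l≡0 = 1≢0 (≡0-by-combination l (-v 1v)
        (solve 1 (λ l → 𝟙 := l :* l :+ (:- 𝟙) :* (l :* l :- 𝟙)) refl l) l≡0 l²-1≡0)

      2l≢0 : l +v l ≢ 0v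
      2l≢0 2l≡0 = 2≢0 (≡0-by-combination l (-v (1v +v 1v))
        (solve 1 (λ l → 𝟙 :+ 𝟙 := l :* (l :+ l) :+ (:- (𝟙 :+ 𝟙)) :* (l :* l :- 𝟙)) refl l) 2l≡0 l²-1≡0)

      2l-1≢0 : l +v l -v 1v ≢ 0v
      2l-1≢0 2l-1≡0 = l+1≢0 (≡0-by-combination ((l +v l +v 1v) *v l -v 1v) (-v (1v +v 1v +v 1v +v 1v) *v l)
        (solve 1 (λ l → l :+ 𝟙 := ((l :+ l :+ 𝟙) :* l :- 𝟙) :* (l :+ l :- 𝟙)
                                  :+ (:- (𝟙 :+ 𝟙 :+ 𝟙 :+ 𝟙)) :* l :* (l :* l :- 𝟙)) refl l) 2l-1≡0 l²-1≡0)

      l-2≢0 : l -v (1v +v 1v) ≢ 0v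
      l-2≢0 l-2≡0 = l+1≢0 (≡0-by-combination (1v -v (l +v 1v +v 1v)) 1v
        (solve 1 (λ l → l :+ 𝟙 := (𝟙 :- (l :+ 𝟙 :+ 𝟙)) :* (l :- (𝟙 :+ 𝟙)) :+ 𝟙 :* (l :* l :- 𝟙)) refl l) l-2≡0 l²-1≡0)

      A-admissible : Admissible 1v l
      A-admissible = record
        { α-invertible = invertible-1
        ; β≢0 = l≢0
        ; α-β≢0 = ≢0-by-≡-v (solve 1 (λ l → 𝟙 :- l := :- (l :- 𝟙)) refl l) l-1≢0
        ; 2α≢0 = 2≢0
        ; 2β≢0 = 2l≢0
        ; α+β≢0 = ≢0-by-≡ (+v-comm 1v l) l+1≢0
        ; 2α-β≢0 = ≢0-by-≡-v (solve 1 (λ l → 𝟙 :+ 𝟙 :- l := :- (l :- (𝟙 :+ 𝟙))) refl l) l-2≢0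
        ; 2β-α≢0 = 2l-1≢0
        ; 2[α-β]≢0 = ≢0-by-≡-v (solve 1 (λ l → (𝟙 :- l) :+ (𝟙 :- l) := :- ((l :- 𝟙) :+ (l :- 𝟙))) refl l) 2[l-1]≢0 }

      B-admissible : Admissible (-v 1v) (l -v 1v)
      B-admissible = record
        { α-invertible = invertible-neg invertible-1
        ; β≢0 = l-1≢0
        ; α-β≢0 = ≢0-by-≡-v (solve 1 (λ l → (:- 𝟙) :- (l :- 𝟙) := :- l) refl l) l≢0
        ; 2α≢0 = ≢0-by-≡-v (solve 0 (:- 𝟙 :+ :- 𝟙 := :- (𝟙 :+ 𝟙)) refl) 2≢0
        ; 2β≢0 = 2[l-1]≢0
        ; α+β≢0 = ≢0-by-≡ (solve 1 (λ l → (:- 𝟙) :+ (l :- 𝟙) := l :- (𝟙 :+ 𝟙)) refl l) l-2≢0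
        ; 2α-β≢0 = ≢0-by-≡-v (solve 1 (λ l → (:- 𝟙) :+ (:- 𝟙) :- (l :- 𝟙) := :- (l :+ 𝟙)) refl l) l+1≢0
        ; 2β-α≢0 = ≢0-by-≡ (solve 1 (λ l → (l :- 𝟙) :+ (l :- 𝟙) :- (:- 𝟙) := l :+ l :- 𝟙) refl l) 2l-1≢0
        ; 2[α-β]≢0 = ≢0-by-≡-v (solve 1 (λ l → ((:- 𝟙) :- (l :- 𝟙)) :+ ((:- 𝟙) :- (l :- 𝟙)) := :- (l :+ l)) refl l) 2l≢0 }

      A-NCond : ∀ c → Invertible c → NCond l (A c)
      A-NCond c c-inv =
        subst InBcon3 (sym A≡scaled) (triple-InBcon3 c-inv A-admissible) , ∈-triple₁ , 0v , ∈-triple₁ , A-shift c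
        where
        A≡scaled : A c ≡ triple 0v (c *v 1v) (c *v l)
        A≡scaled = cong₂ (triple 0v) (sym (trans (*v-comm c 1v) (*v-identityˡ c))) (*v-comm l c)

      B-NCond : ∀ c → Invertible c → NCond l (B c)
      B-NCond c c-inv =
        subst InBcon3 (sym B≡scaled) (triple-InBcon3 c-inv B-admissible) ,
        ∈-triple₁ , (l -v 1v) *v c , ∈-triple₃ , B-shift c
        where
        B≡scaled : B c ≡ triple 0v (c *v (-v 1v)) (c *v (l -v 1v))
        B≡scaled = cong₂ (triple 0v) (solve 1 (λ c → :- c := c :* (:- 𝟙)) refl c) (*v-comm (l -v 1v) c)

      A≡A⇒ : ∀ {c c′} → Invertible c → A c ≡ A c′ → c ≡ c′ ⊎ c ≡ l *v c′
      A≡A⇒ {c} {c′} c-inv A≡A with ∈-triple⁻ (subst (c ∈ₛ_) A≡A ∈-triple₂)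
      ... | inj₁ c≡0 = ⊥-elim (invertible⇒≢0 1≢0 c-inv c≡0)
      ... | inj₂ c∈ = c∈

      B-injective : ∀ {c c′} → Invertible c → Invertible c′ → B c ≡ B c′ → c ≡ c′
      B-injective {c} {c′} c-inv c′-inv B≡B =
        cases (∈-triple⁻ (subst (-v c ∈ₛ_) B≡B ∈-triple₂)) (∈-triple⁻ (subst ((l -v 1v) *v c ∈ₛ_) B≡B ∈-triple₃))
        where
        c≢0 = invertible⇒≢0 1≢0 c-inv
        cases : OneOf (-v c) 0v (-v c′) ((l -v 1v) *v c′) → OneOf ((l -v 1v) *v c) 0v (-v c′) ((l -v 1v) *v c′) → c ≡ c′
        cases (inj₁ -c≡0) _ = ⊥-elim (-v≢0 c≢0 -c≡0)
        cases (inj₂ (inj₁ -c≡-c′)) _ = -v-injective -c≡-c′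
        cases (inj₂ (inj₂ _)) (inj₁ [l-1]c≡0) = ⊥-elim (l-1≢0 (invertible-*≡0 c-inv (trans (*v-comm c _) [l-1]c≡0)))
        cases (inj₂ (inj₂ -c≡[l-1]c′)) (inj₂ (inj₂ [l-1]c≡[l-1]c′)) =
          ⊥-elim (c≢0 (invertible-*≡0 l-invertible (begin
            l *v c                      ≡⟨ solve 2 (λ l c → l :* c := (l :- 𝟙) :* c :+ c) refl l c ⟩
            (l -v 1v) *v c +v c         ≡⟨ cong (_+v c) (trans [l-1]c≡[l-1]c′ (sym -c≡[l-1]c′)) ⟩
            (-v c) +v c                 ≡⟨ trans (+v-comm (-v c) c) (+v-inverseʳ c) ⟩
            0v                          ∎)))
        cases (inj₂ (inj₂ -c≡[l-1]c′)) (inj₂ (inj₁ [l-1]c≡-c′)) =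
          ⊥-elim (2l-1≢0 (≡0-by-combination (-v 1v) 1v
            (solve 1 (λ l → l :+ l :- 𝟙 := (:- 𝟙) :* ((l :- 𝟙) :* (l :- 𝟙) :- 𝟙) :+ 𝟙 :* (l :* l :- 𝟙)) refl l)
            (invertible-*≡0 c′-inv c′[[l-1]²-1]≡0) l²-1≡0))
          where
          c′[[l-1]²-1]≡0 : c′ *v ((l -v 1v) *v (l -v 1v) -v 1v) ≡ 0v
          c′[[l-1]²-1]≡0 = begin
            c′ *v ((l -v 1v) *v (l -v 1v) -v 1v)
              ≡⟨ solve 2 (λ l c → c :* ((l :- 𝟙) :* (l :- 𝟙) :- 𝟙) := (l :- 𝟙) :* ((l :- 𝟙) :* c) :- c) refl l c′ ⟩
            (l -v 1v) *v ((l -v 1v) *v c′) -v c′  ≡⟨ cong (λ z → (l -v 1v) *v z -v c′) -c≡[l-1]c′ ⟨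
            (l -v 1v) *v (-v c) -v c′             ≡⟨ cong (_-v c′) (sym (-v-distribʳ-*v (l -v 1v) c)) ⟩
            -v ((l -v 1v) *v c) -v c′             ≡⟨ cong (λ z → -v z -v c′) [l-1]c≡-c′ ⟩
            -v (-v c′) -v c′                      ≡⟨ solve 1 (λ c → :- (:- c) :- c := 𝟘) refl c′ ⟩
            0v                                    ∎

      l*c≢c : ∀ {c} → Invertible c → l *v c ≢ c
      l*c≢c {c} c-inv lc≡c = l-1≢0 (invertible-*≡0 c-inv (begin
        c *v (l -v 1v)  ≡⟨ solve 2 (λ l c → c :* (l :- 𝟙) := l :* c :- c) refl l c ⟩
        l *v c -v c     ≡⟨ cong (_-v c) lc≡c ⟩
        c -v c          ≡⟨ +v-inverseʳ c ⟩
        0v              ∎))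

      A≢B : ∀ {c d} → Invertible c → Invertible d → A c ≢ B d
      A≢B {c} {d} c-inv d-inv A≡B =
        cases (∈-triple⁻ (subst (c ∈ₛ_) A≡B ∈-triple₂)) (∈-triple⁻ (subst (l *v c ∈ₛ_) A≡B ∈-triple₃))
        where
        c≢0 = invertible⇒≢0 1≢0 c-inv
        cases : OneOf c 0v (-v d) ((l -v 1v) *v d) → OneOf (l *v c) 0v (-v d) ((l -v 1v) *v d) → ⊥
        cases (inj₁ c≡0) _ = c≢0 c≡0
        cases (inj₂ _) (inj₁ lc≡0) = c≢0 (invertible-*≡0 l-invertible lc≡0)
        cases (inj₂ (inj₁ c≡-d)) (inj₂ (inj₁ lc≡-d)) = l*c≢c c-inv (trans lc≡-d (sym c≡-d))
        cases (inj₂ (inj₂ c≡[l-1]d)) (inj₂ (inj₂ lc≡[l-1]d)) = l*c≢c c-inv (trans lc≡[l-1]d (sym c≡[l-1]d))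
        cases (inj₂ (inj₁ c≡-d)) (inj₂ (inj₂ lc≡[l-1]d)) = 2l-1≢0 (invertible-*≡0 c-inv (begin
          c *v (l +v l -v 1v)               ≡⟨ solve 2 (λ l c → c :* (l :+ l :- 𝟙) := l :* c :- (l :- 𝟙) :* (:- c)) refl l c ⟩
          l *v c -v (l -v 1v) *v (-v c)     ≡⟨ cong (λ z → l *v c -v (l -v 1v) *v z) (trans (cong (λ z → -v z) c≡-d) (-v-involutive d)) ⟩
          l *v c -v (l -v 1v) *v d          ≡⟨ cong (λ z → l *v c -v z) lc≡[l-1]d ⟨
          l *v c -v l *v c                  ≡⟨ +v-inverseʳ (l *v c) ⟩
          0v                                ∎))
        cases (inj₂ (inj₂ c≡[l-1]d)) (inj₂ (inj₁ lc≡-d)) = l-2≢0 (invertible-*≡0 d-inv (begin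
          d *v (l -v (1v +v 1v))
            ≡⟨ solve 2 (λ l d → d :* (l :- (𝟙 :+ 𝟙)) := d :* (l :* l :- 𝟙) :- (l :* ((l :- 𝟙) :* d) :+ d)) refl l d ⟩
          d *v (l *v l -v 1v) -v (l *v ((l -v 1v) *v d) +v d)  ≡⟨ cong₂ (λ x y → d *v x -v (l *v y +v d)) l²-1≡0 (sym c≡[l-1]d) ⟩
          d *v 0v -v (l *v c +v d)                             ≡⟨ cong (λ z → d *v 0v -v (z +v d)) lc≡-d ⟩
          d *v 0v -v ((-v d) +v d)                             ≡⟨ solve 1 (λ d → d :* 𝟘 :- ((:- d) :+ d) := 𝟘) refl d ⟩
          0v                                                   ∎))

      -- Each set A c arises from exactly two units, c and l c; keep the one with the smaller residue.
      Lesser : ℤv → Set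
      Lesser c = toℕ c < toℕ (l *v c)

      lesser? : ∀ c → Dec (Lesser c)
      lesser? c = toℕ c <? toℕ (l *v c)

      lesser greater : List ℤv
      lesser  = filter lesser? units
      greater = filter (¬? ∘ lesser?) units

      ¬Lesser⇒Lesser-l* : ∀ {c} → Invertible c → ¬ Lesser c → Lesser (l *v c)
      ¬Lesser⇒Lesser-l* {c} c-inv ¬lesser = subst (λ z → toℕ (l *v c) < toℕ z) (sym (l*[l*c]≡c c))
        (≤∧≢⇒< (≮⇒≥ ¬lesser) (λ eq → l*c≢c c-inv (toℕ-injective eq)))

      l*-lesser⊆greater : map (l *v_) lesser ⊆ greater
      l*-lesser⊆greater lc∈ with c , c∈ , refl ← ∈-map⁻ (l *v_) lc∈ with c∈units , lesser-c ← ∈-filter⁻ lesser? {xs = units} c∈ =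
        ∈-filter⁺ (¬? ∘ lesser?) (Invertible⇒∈units (invertible-* l-invertible (∈units⇒Invertible c∈units)))
          (λ lesser-lc → <-asym lesser-c (subst (λ z → toℕ (l *v c) < toℕ z) (l*[l*c]≡c c) lesser-lc))

      l*-greater⊆lesser : map (l *v_) greater ⊆ lesser
      l*-greater⊆lesser lc∈ with c , c∈ , refl ← ∈-map⁻ (l *v_) lc∈ with c∈units , ¬lesser-c ← ∈-filter⁻ (¬? ∘ lesser?) {xs = units} c∈ =
        ∈-filter⁺ lesser? (Invertible⇒∈units (invertible-* l-invertible (∈units⇒Invertible c∈units)))
          (¬Lesser⇒Lesser-l* (∈units⇒Invertible c∈units) ¬lesser-c)

      length-lesser≡length-greater : length lesser ≡ length greater
      length-lesser≡length-greater = ≤-antisym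
        (subst (_≤ length greater) (length-map (l *v_) lesser)
          (Unique-⊆⇒length≤ (Unique.map⁺ (*v-cancelˡ l-invertible) (Unique.filter⁺ lesser? Unique-units)) l*-lesser⊆greater))
        (subst (_≤ length lesser) (length-map (l *v_) greater)
          (Unique-⊆⇒length≤ (Unique.map⁺ (*v-cancelˡ l-invertible) (Unique.filter⁺ (¬? ∘ lesser?) Unique-units)) l*-greater⊆lesser))

      φ≡2*length-lesser : φ v ≡ length lesser + length lesser
      φ≡2*length-lesser = begin
        φ v                                 ≡⟨ length-units ⟨
        length units                        ≡⟨ length-filter+length-filter-¬ lesser? units ⟨
        length lesser + length greater     ≡⟨ cong (λ k → length lesser + k) length-lesser≡length-greater ⟨
        length lesser + length lesser      ∎

      families : List (Subset v)
      families = map A lesser ++ map B units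

      ∈lesser⇒Invertible : ∀ {c} → c ∈ lesser → Invertible c
      ∈lesser⇒Invertible c∈ = ∈units⇒Invertible (proj₁ (∈-filter⁻ lesser? {xs = units} c∈))

      Unique-families : Unique families
      Unique-families = Unique.++⁺
        (Unique-map⁺ A A-injective (Unique.filter⁺ lesser? Unique-units))
        (Unique-map⁺ B (λ c∈ c′∈ → B-injective (∈units⇒Invertible c∈) (∈units⇒Invertible c′∈)) Unique-units)
        disjoint
        where
        A-injective : ∀ {c c′} → c ∈ lesser → c′ ∈ lesser → A c ≡ A c′ → c ≡ c′
        A-injective {c} {c′} c∈ c′∈ A≡A with A≡A⇒ (∈lesser⇒Invertible c∈) A≡A
        ... | inj₁ c≡c′ = c≡c′
        ... | inj₂ refl = ⊥-elim (<-asym (proj₂ (∈-filter⁻ lesser? {xs = units} c′∈))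
                (subst (λ z → toℕ (l *v c′) < toℕ z) (l*[l*c]≡c c′) (proj₂ (∈-filter⁻ lesser? {xs = units} c∈))))
        disjoint : ∀ {X} → ¬ (X ∈ map A lesser × X ∈ map B units)
        disjoint (X∈A , X∈B) with c , c∈ , refl ← ∈-map⁻ A X∈A with d , d∈ , A≡B ← ∈-map⁻ B X∈B =
          A≢B (∈lesser⇒Invertible c∈) (∈units⇒Invertible d∈) A≡B

      count : N≡ l ((3 * φ v) / 2)
      count = families , Unique-families , (λ X → mk⇔ ∈families⇒NCond NCond⇒∈families) , length-families
        where
        ∈families⇒NCond : ∀ {X} → X ∈ families → NCond l X
        ∈families⇒NCond X∈ with ∈-++⁻ (map A lesser) X∈
        ... | inj₁ X∈A with c , c∈ , refl ← ∈-map⁻ A X∈A = A-NCond c (∈lesser⇒Invertible c∈)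
        ... | inj₂ X∈B with c , c∈ , refl ← ∈-map⁻ B X∈B = B-NCond c (∈units⇒Invertible c∈)
        NCond⇒∈families : ∀ {X} → NCond l X → X ∈ families
        NCond⇒∈families ncond with NCond⇒Shape ncond
        ... | inj₂ (inj₂ (_ , _ , cyclotomic , _)) = ⊥-elim (¬cyclotomic cyclotomic)
        ... | inj₂ (inj₁ (c , c-inv , _ , refl)) = ∈-++⁺ʳ (map A lesser) (∈-map⁺ B (Invertible⇒∈units c-inv))
        ... | inj₁ (c , c-inv , _ , refl) with lesser? c
        ...   | yes lesser-c = ∈-++⁺ˡ (∈-map⁺ A (∈-filter⁺ lesser? (Invertible⇒∈units c-inv) lesser-c))
        ...   | no ¬lesser-c = subst (_∈ families) (sym (A≡A[l*] c)) (∈-++⁺ˡ (∈-map⁺ A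
                  (∈-filter⁺ lesser? (Invertible⇒∈units (invertible-* l-invertible c-inv)) (¬Lesser⇒Lesser-l* c-inv ¬lesser-c))))
        length-families : length families ≡ (3 * φ v) / 2
        length-families = begin
          length families                        ≡⟨ length-++ (map A lesser) ⟩
          length (map A lesser) + length (map B units)
            ≡⟨ cong₂ _+_ (length-map A lesser) (trans (length-map B units) (trans length-units φ≡2*length-lesser)) ⟩
          h + (h + h)                            ≡⟨ m*n/n≡m (h + (h + h)) 2 ⟨
          ((h + (h + h)) * 2) / 2                ≡⟨ cong (_/ 2) ([h+[h+h]]*2≡3*[h+h] h) ⟩
          (3 * (h + h)) / 2                      ≡⟨ cong (λ z → (3 * z) / 2) φ≡2*length-lesser ⟨
          (3 * φ v) / 2                          ∎
          where h = length lesser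

  module Cubic (cyclotomic : l *v l +v l +v 1v ≡ 0v) (2≢0 : 1v +v 1v ≢ 0v) where

    1≢0 : 1v ≢ 0v
    1≢0 = 2≢0⇒1≢0 2≢0

    l≢0 : l ≢ 0v
    l≢0 l≡0 = 1≢0 (≡0-by-combination (-v (l +v 1v)) 1v
      (solve 1 (λ l → 𝟙 := (:- (l :+ 𝟙)) :* l :+ 𝟙 :* (l :* l :+ l :+ 𝟙)) refl l) l≡0 cyclotomic)

    1+l≢0 : 1v +v l ≢ 0v
    1+l≢0 1+l≡0 = 1≢0 (≡0-by-combination (-v l) 1v
      (solve 1 (λ l → 𝟙 := (:- l) :* (𝟙 :+ l) :+ 𝟙 :* (l :* l :+ l :+ 𝟙)) refl l) 1+l≡0 cyclotomic)

    l+2≢0 : l +v (1v +v 1v) ≢ 0v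
    l+2≢0 l+2≡0 = l-1≢0 (≡0-by-combination l (-v 1v)
      (solve 1 (λ l → l :- 𝟙 := l :* (l :+ (𝟙 :+ 𝟙)) :+ (:- 𝟙) :* (l :* l :+ l :+ 𝟙)) refl l) l+2≡0 cyclotomic)

    2[1+l]≢0 : (1v +v l) +v (1v +v l) ≢ 0v
    2[1+l]≢0 2[1+l]≡0 = 2≢0 (≡0-by-combination (-v l) (1v +v 1v)
      (solve 1 (λ l → 𝟙 :+ 𝟙 := (:- l) :* ((𝟙 :+ l) :+ (𝟙 :+ l)) :+ (𝟙 :+ 𝟙) :* (l :* l :+ l :+ 𝟙)) refl l) 2[1+l]≡0 cyclotomic)

    1+2l≢0 : 1v +v l +v l ≢ 0v
    1+2l≢0 1+2l≡0 = l-1≢0 (≡0-by-combination (-v (l *v (1v +v l +v l)) -v 1v) ((1v +v 1v +v 1v +v 1v) *v l)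
      (solve 1 (λ l → l :- 𝟙 := ((:- (l :* (𝟙 :+ l :+ l))) :- 𝟙) :* (𝟙 :+ l :+ l)
                                 :+ ((𝟙 :+ 𝟙 :+ 𝟙 :+ 𝟙) :* l) :* (l :* l :+ l :+ 𝟙)) refl l) 1+2l≡0 cyclotomic)

    2l≢0 : l +v l ≢ 0v
    2l≢0 2l≡0 = 2≢0 (≡0-by-combination (l *v l) (-v ((1v +v 1v) *v (l -v 1v)))
      (solve 1 (λ l → 𝟙 :+ 𝟙 := (l :* l) :* (l :+ l) :+ (:- ((𝟙 :+ 𝟙) :* (l :- 𝟙))) :* (l :* l :+ l :+ 𝟙)) refl l) 2l≡0 cyclotomic)

    T-admissible : Admissible 1v (1v +v l)
    T-admissible = record
      { α-invertible = invertible-1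
      ; β≢0 = 1+l≢0
      ; α-β≢0 = ≢0-by-≡-v (solve 1 (λ l → 𝟙 :- (𝟙 :+ l) := :- l) refl l) l≢0
      ; 2α≢0 = 2≢0
      ; 2β≢0 = 2[1+l]≢0
      ; α+β≢0 = ≢0-by-≡ (solve 1 (λ l → 𝟙 :+ (𝟙 :+ l) := l :+ (𝟙 :+ 𝟙)) refl l) l+2≢0
      ; 2α-β≢0 = ≢0-by-≡-v (solve 1 (λ l → 𝟙 :+ 𝟙 :- (𝟙 :+ l) := :- (l :- 𝟙)) refl l) l-1≢0
      ; 2β-α≢0 = ≢0-by-≡ (solve 1 (λ l → (𝟙 :+ l) :+ (𝟙 :+ l) :- 𝟙 := 𝟙 :+ l :+ l) refl l) 1+2l≢0
      ; 2[α-β]≢0 = ≢0-by-≡-v (solve 1 (λ l → (𝟙 :- (𝟙 :+ l)) :+ (𝟙 :- (𝟙 :+ l)) := :- (l :+ l)) refl l) 2l≢0 }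

    l*[1+l]c≡-c : ∀ c → l *v ((1v +v l) *v c) ≡ 0v -v c
    l*[1+l]c≡-c c = begin
      l *v ((1v +v l) *v c)            ≡⟨ solve 2 (λ l c → l :* ((𝟙 :+ l) :* c) := (l :* l :+ l :+ 𝟙) :* c :- c) refl l c ⟩
      (l *v l +v l +v 1v) *v c -v c    ≡⟨ cong (λ z → z *v c -v c) cyclotomic ⟩
      0v *v c -v c                     ≡⟨ cong (_-v c) (*v-zeroˡ c) ⟩
      0v -v c                          ∎

    T-shift : ∀ c → ScaledEqShift l (T c) c
    T-shift c y = mk⇔ to from
      where
      to : InScaled l (T c) y → InShift (T c) c y
      to (x , x∈ , refl) with ∈-triple⁻ x∈
      ... | inj₁ refl        = c , ∈-triple₂ , trans (*v-zeroʳ l) (sym (+v-inverseʳ c))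
      ... | inj₂ (inj₁ refl) = (1v +v l) *v c , ∈-triple₃ , solve 2 (λ l c → l :* c := (𝟙 :+ l) :* c :- c) refl l c
      ... | inj₂ (inj₂ refl) = 0v , ∈-triple₁ , l*[1+l]c≡-c c
      from : InShift (T c) c y → InScaled l (T c) y
      from (x′ , x′∈ , refl) with ∈-triple⁻ x′∈
      ... | inj₁ refl        = (1v +v l) *v c , ∈-triple₃ , sym (l*[1+l]c≡-c c)
      ... | inj₂ (inj₁ refl) = 0v , ∈-triple₁ , trans (+v-inverseʳ c) (sym (*v-zeroʳ l))
      ... | inj₂ (inj₂ refl) = c , ∈-triple₂ , solve 2 (λ l c → (𝟙 :+ l) :* c :- c := l :* c) refl l c

    T-NCond : ∀ c → Invertible c → NCond l (T c)
    T-NCond c c-inv = subst InBcon3 (sym T≡scaled) (triple-InBcon3 c-inv T-admissible) , ∈-triple₁ , c , ∈-triple₂ , T-shift c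
      where
      T≡scaled : T c ≡ triple 0v (c *v 1v) (c *v (1v +v l))
      T≡scaled = cong₂ (triple 0v) (sym (trans (*v-comm c 1v) (*v-identityˡ c))) (*v-comm (1v +v l) c)

    1+l-invertible : Invertible (1v +v l)
    1+l-invertible = -v l , (begin
      (-v l) *v (1v +v l)          ≡⟨ solve 1 (λ l → (:- l) :* (𝟙 :+ l) := 𝟙 :- (l :* l :+ l :+ 𝟙)) refl l ⟩
      1v -v (l *v l +v l +v 1v)    ≡⟨ cong (λ z → 1v -v z) cyclotomic ⟩
      1v -v 0v                     ≡⟨ -v-identityʳ 1v ⟩
      1v                           ∎)

    T-injective : ∀ {c c′} → Invertible c → Invertible c′ → T c ≡ T c′ → c ≡ c′
    T-injective {c} {c′} c-inv c′-inv T≡T =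
      cases (∈-triple⁻ (subst (c ∈ₛ_) T≡T ∈-triple₂)) (∈-triple⁻ (subst ((1v +v l) *v c ∈ₛ_) T≡T ∈-triple₃))
      where
      c≢0 = invertible⇒≢0 1≢0 c-inv
      cases : OneOf c 0v c′ ((1v +v l) *v c′) → OneOf ((1v +v l) *v c) 0v c′ ((1v +v l) *v c′) → c ≡ c′
      cases (inj₁ c≡0) _ = ⊥-elim (c≢0 c≡0)
      cases (inj₂ (inj₁ c≡c′)) _ = c≡c′
      cases (inj₂ (inj₂ _)) (inj₁ [1+l]c≡0) = ⊥-elim (c≢0 (invertible-*≡0 1+l-invertible [1+l]c≡0))
      cases (inj₂ (inj₂ _)) (inj₂ (inj₂ [1+l]c≡[1+l]c′)) = *v-cancelˡ 1+l-invertible [1+l]c≡[1+l]c′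
      cases (inj₂ (inj₂ c≡[1+l]c′)) (inj₂ (inj₁ [1+l]c≡c′)) =
        ⊥-elim (l-1≢0 (≡0-by-combination 1v (-v 1v)
          (solve 1 (λ l → l :- 𝟙 := 𝟙 :* ((𝟙 :+ l) :* (𝟙 :+ l) :- 𝟙) :+ (:- 𝟙) :* (l :* l :+ l :+ 𝟙)) refl l)
          (invertible-*≡0 c′-inv c′[[1+l]²-1]≡0) cyclotomic))
        where
        c′[[1+l]²-1]≡0 : c′ *v ((1v +v l) *v (1v +v l) -v 1v) ≡ 0v
        c′[[1+l]²-1]≡0 = begin
          c′ *v ((1v +v l) *v (1v +v l) -v 1v)
            ≡⟨ solve 2 (λ l c → c :* ((𝟙 :+ l) :* (𝟙 :+ l) :- 𝟙) := (𝟙 :+ l) :* ((𝟙 :+ l) :* c) :- c) refl l c′ ⟩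
          (1v +v l) *v ((1v +v l) *v c′) -v c′  ≡⟨ cong (λ z → (1v +v l) *v z -v c′) c≡[1+l]c′ ⟨
          (1v +v l) *v c -v c′                  ≡⟨ cong (_-v c′) [1+l]c≡c′ ⟩
          c′ -v c′                              ≡⟨ +v-inverseʳ c′ ⟩
          0v                                    ∎

    count : l *v l ≢ 1v → N≡ l (φ v)
    count l²≢1 = map T units , Unique-map⁺ T (λ c∈ c′∈ → T-injective (∈units⇒Invertible c∈) (∈units⇒Invertible c′∈)) Unique-units ,
                 (λ X → mk⇔ ∈families⇒NCond NCond⇒∈families) , trans (length-map T units) length-units
      where
      ∈families⇒NCond : ∀ {X} → X ∈ map T units → NCond l X
      ∈families⇒NCond X∈ with c , c∈ , refl ← ∈-map⁻ T X∈ = T-NCond c (∈units⇒Invertible c∈)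
      NCond⇒∈families : ∀ {X} → NCond l X → X ∈ map T units
      NCond⇒∈families ncond with NCond⇒Shape ncond
      ... | inj₁ (_ , _ , l²≡1 , _) = ⊥-elim (l²≢1 l²≡1)
      ... | inj₂ (inj₁ (_ , _ , l²≡1 , _)) = ⊥-elim (l²≢1 l²≡1)
      ... | inj₂ (inj₂ (c , c-inv , _ , refl)) = ∈-map⁺ T (Invertible⇒∈units c-inv)

module Orders (v : ℕ) .{{_ : NonZero v}} (l : ℤmod.ℤv v) (l-unit : ℤmod.IsUnit v l) (l≢1 : l ≢ ℤmod.1v v) where
  open ℤmod v
  open Residues v

  l-invertible : Invertible l
  l-invertible = coprime⇒invertible l l-unit

  open Scaling v l l-invertible l≢1

  2≢0 : 1v +v 1v ≢ 0v
  2≢0 2≡0 = l≢1 (v≤2⇒unit≡1 v l l-unit (∣⇒≤ ([]≡0⇒∣ 2 (trans (sym ([]-+ 1 1)) 2≡0))))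

  no-Shape⇒N≡0 : l *v l ≢ 1v → l *v l +v l +v 1v ≢ 0v → N≡ l 0
  no-Shape⇒N≡0 l²≢1 ¬cyclotomic = CountIs-none λ X ncond → impossible (NCond⇒Shape ncond)
    where
    impossible : ∀ {X} → Shape X → ⊥
    impossible (inj₁ (_ , _ , l²≡1 , _))        = l²≢1 l²≡1
    impossible (inj₂ (inj₁ (_ , _ , l²≡1 , _))) = l²≢1 l²≡1
    impossible (inj₂ (inj₂ (_ , _ , cyclotomic , _))) = ¬cyclotomic cyclotomic

  order>3⇒N≡0 : ∀ o → IsOrder l o → 3 < o → N≡ l 0
  order>3⇒N≡0 o (_ , _ , minimal) 3<o = no-Shape⇒N≡0
    (λ l²≡1 → minimal 2 (s≤s z≤n) (<-trans (s≤s (s≤s (s≤s z≤n))) 3<o) (trans (^v-2 l) l²≡1))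
    (λ cyclotomic → minimal 3 (s≤s z≤n) 3<o (trans (^v-3 l) (x²+x+1≡0⇒x³≡1 cyclotomic)))

  [l²+l+1]≡l*l+l+1 : [ toℕ l ^ 2 + toℕ l + 1 ] ≡ l *v l +v l +v 1v
  [l²+l+1]≡l*l+l+1 = begin
    [ toℕ l ^ 2 + toℕ l + 1 ]      ≡⟨ []-+ (toℕ l ^ 2 + toℕ l) 1 ⟨
    [ toℕ l ^ 2 + toℕ l ] +v 1v    ≡⟨ cong (_+v 1v) ([]-+ (toℕ l ^ 2) (toℕ l)) ⟨
    l ^v 2 +v [ toℕ l ] +v 1v      ≡⟨ cong₂ (λ a b → a +v b +v 1v) (^v-2 l) ([]-toℕ l) ⟩
    l *v l +v l +v 1v              ∎

  order3 : IsOrder l 3 → (¬ (v ∣ toℕ l ^ 2 + toℕ l + 1) → N≡ l 0) × ((v ∣ toℕ l ^ 2 + toℕ l + 1) → N≡ l (φ v))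
  order3 (_ , _ , minimal) =
    (λ v∤ → no-Shape⇒N≡0 l²≢1 (λ cyclotomic → v∤ ([]≡0⇒∣ _ (trans [l²+l+1]≡l*l+l+1 cyclotomic)))) ,
    (λ v∣ → Cubic.count (trans (sym [l²+l+1]≡l*l+l+1) (∣⇒[]≡0 _ v∣)) 2≢0 l²≢1)
    where
    l²≢1 : l *v l ≢ 1v
    l²≢1 l²≡1 = minimal 2 (s≤s z≤n) (s≤s (s≤s (s≤s z≤n))) (trans (^v-2 l) l²≡1)

  Degenerate : Set
  Degenerate = (v ∣ toℕ l + 1) ⊎ ((4 ∣ v) × ((v / 2) ∣ (toℕ l ∸ 1)))

  private
    m = toℕ l ∸ 1

    1+m≡l : suc m ≡ toℕ l
    1+m≡l = n≢0⇒1+[n∸1]≡n λ l≡0 →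
      invertible⇒≢0 (2≢0⇒1≢0 2≢0) l-invertible (toℕ-injective (trans l≡0 (sym (trans (toℕ-[] 0) 0%v≡0))))

    m<v : m < v
    m<v = <-trans (n<1+n m) (subst (_< v) (sym 1+m≡l) (toℕ<n l))

    2[l-1]≡[m+m] : (l -v 1v) +v (l -v 1v) ≡ [ m + m ]
    2[l-1]≡[m+m] = trans (cong₂ _+v_ l-1≡[m] l-1≡[m]) ([]-+ m m)
      where
      l-1≡[m] : l -v 1v ≡ [ m ]
      l-1≡[m] = begin
        l -v 1v                 ≡⟨ cong (_-v 1v) ([]-toℕ l) ⟨
        [ toℕ l ] -v 1v         ≡⟨ cong (λ n → [ n ] -v 1v) 1+m≡l ⟨
        [ 1 + m ] -v 1v         ≡⟨ cong (_-v 1v) ([]-+ 1 m) ⟨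
        (1v +v [ m ]) -v 1v     ≡⟨ solve 1 (λ x → (𝟙 :+ x) :- 𝟙 := x) refl [ m ] ⟩
        [ m ]                   ∎

    l+1≡[l+1] : l +v 1v ≡ [ toℕ l + 1 ]
    l+1≡[l+1] = trans (cong (_+v 1v) (sym ([]-toℕ l))) ([]-+ (toℕ l) 1)

  Degenerate⇒ : Degenerate → l +v 1v ≡ 0v ⊎ (l -v 1v) +v (l -v 1v) ≡ 0v
  Degenerate⇒ (inj₁ v∣l+1) = inj₁ (trans l+1≡[l+1] (∣⇒[]≡0 _ v∣l+1))
  Degenerate⇒ (inj₂ (4∣v , v/2∣m)) =
    inj₂ (trans 2[l-1]≡[m+m] (∣⇒[]≡0 _ (n/2∣m⇒n∣m+m (∣-trans (divides 2 refl) 4∣v) v/2∣m)))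

  ¬Degenerate⇒l+1≢0 : ¬ Degenerate → l +v 1v ≢ 0v
  ¬Degenerate⇒l+1≢0 ¬degenerate l+1≡0 = ¬degenerate (inj₁ ([]≡0⇒∣ _ (trans (sym l+1≡[l+1]) l+1≡0)))

  ¬Degenerate⇒2[l-1]≢0 : ¬ Degenerate → (l -v 1v) +v (l -v 1v) ≢ 0v
  ¬Degenerate⇒2[l-1]≢0 ¬degenerate 2[l-1]≡0 =
    [ m≢0 , v≢m+m ]′ (m<n∧n∣m+m⇒m≡0⊎n≡m+m m<v ([]≡0⇒∣ (m + m) (trans (sym 2[l-1]≡[m+m]) 2[l-1]≡0)))
    where
    m≢0 : m ≢ 0
    m≢0 m≡0 = l≢1 (trans (sym ([]-toℕ l)) (cong [_] (trans (sym 1+m≡l) (cong suc m≡0))))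
    v≢m+m : v ≢ m + m
    v≢m+m v≡m+m = [ 2∤1+m , 4∤m+m ]′ (2∣1+m⊎4∣m+m m)
      where
      2∤1+m : ¬ 2 ∣ suc m
      2∤1+m 2∣1+m with () ← l-unit (subst (2 ∣_) 1+m≡l 2∣1+m , divides m (trans v≡m+m ([m+m≡m*2] m)))
      4∤m+m : ¬ 4 ∣ m + m
      4∤m+m 4∣m+m = ¬degenerate (inj₂ (subst (4 ∣_) (sym v≡m+m) 4∣m+m ,
                                      subst (_∣ m) (sym (trans (cong (_/ 2) v≡m+m) ([m+m]/2≡m m))) ∣-refl))

  order2 : IsOrder l 2 → (Degenerate → N≡ l 0) × (¬ Degenerate → N≡ l ((3 * φ v) / 2))
  order2 (_ , l^2≡1 , _) =
    (λ degenerate → CountIs-none (degenerate⇒¬NCond (Degenerate⇒ degenerate))) ,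
    (λ ¬degenerate → Nondegenerate.count 2≢0 (¬Degenerate⇒l+1≢0 ¬degenerate) (¬Degenerate⇒2[l-1]≢0 ¬degenerate))
    where open Involution (trans (sym (^v-2 l)) l^2≡1)

lemma17 : (v : ℕ) .{{_ : NonZero v}} (l : ℤmod.ℤv v) →
            ℤmod.IsUnit v l → ¬ (l ≡ ℤmod.1v v) →
            ((o : ℕ) → ℤmod.IsOrder v l o → 3 < o → ℤmod.N≡ v l 0)
            × ((ℤmod.IsOrder v l 2 →
                 (((v ∣ toℕ l + 1) ⊎ ((4 ∣ v) × ((v / 2) ∣ (toℕ l ∸ 1)))) → ℤmod.N≡ v l 0)
               × (¬ ((v ∣ toℕ l + 1) ⊎ ((4 ∣ v) × ((v / 2) ∣ (toℕ l ∸ 1)))) →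
                    ℤmod.N≡ v l ((3 * φ v) / 2))))
            × (ℤmod.IsOrder v l 3 →
                 (¬ (v ∣ toℕ l ^ 2 + toℕ l + 1) → ℤmod.N≡ v l 0)
               × ((v ∣ toℕ l ^ 2 + toℕ l + 1) → ℤmod.N≡ v l (φ v)))
lemma17 v l l-unit l≢1 = order>3⇒N≡0 , order2 , order3
  where open Orders v l l-unit l≢1
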